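{- Let $R_n$ be the Galois ring of characteristic $4$ and cardinality $4^n$, let $\Gamma(R_n)$ be its Teichmüller set, made into the field $(\Gamma(R_n),\oplus,\cdot)$ with $2^n$ elements via $x\oplus y=x+y+2\sqrt{xy}$. Let $f:\Gamma(R_n)\to\Gamma(R_n)$ be any function and put $D=\{x+2\sqrt{f(x)}:x\in\Gamma(R_n)\}\subseteq R_n$. Then $D$ is a relative difference set in the additive group of $R_n$ with parameters $(2^n,2^n,2^n,1)$ and forbidden subgroup $2R_n$ if and only if $f$ is planar (as a function on the field $(\Gamma(R_n),\oplus,\cdot)$).
   Context: The unit group $R_n\setminus 2R_n$ of $R_n$ contains a cyclic subgroup $\Gamma(R_n)^*$ of order $2^n-1$, and $\Gamma(R_n)=\Gamma(R_n)^*\cup\{0\}$ is the Teichmüller set. With addition $x\oplus y=x+y+2\sqrt{xy}$ (here $+$ is addition in $R_n$ and $\sqrt{z}$ denotes the unique square root of $z$ in $\Gamma(R_n)$, where squaring is multiplication in $R_n$) and the ring multiplication, $\Gamma(R_n)$ is a field with $2^n$ elements. A subset $D$ of a finite group $G$ is a relative difference set with parameters $(|G|/|N|,|N|,|D|,\lambda)$ and forbidden subgroup $N$ if the list of nonzero differences of elements of $D$ contains every element of $G\setminus N$ exactly $\lambda$ times (and no element of $N\setminus\{0\}$). A function $f$ on a field $K$ of characteristic $2$ (with addition $\oplus$) is planar if for each nonzero $\epsilon\in K$ the map $x\mapsto f(x\oplus\epsilon)\oplus f(x)\oplus\epsilon x$ is a permutation of $K$. -}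

module Defs where

open import Data.Nat using (ℕ; zero; suc; _+_; _*_; _^_; _%_; _≡ᵇ_)
open import Data.Nat.DivMod using (_mod_)
open import Data.Fin using (Fin; toℕ) renaming (zero to 0F; suc to sucF)
import Data.Fin as F
open import Data.Bool using (Bool; true; false; _xor_; _∧_; if_then_else_)
open import Data.Vec as V using (Vec; []; _∷_)
import Data.Vec.Properties as VP
open import Data.List as L using (List; length; filter; cartesianProduct; concatMap)
open import Data.List.Relation.Unary.Any using (Any; any?)
open import Data.Product using (_×_; _,_; proj₁; proj₂; Σ; ∃; ∃-syntax)
open import Relation.Nullary using (¬_; Dec; yes; no)
open import Relation.Unary using (Decidable)
open import Relation.Binary.PropositionalEquality using (_≡_)
open import Relation.Binary.Definitions using (DecidableEquality)

-- Relative difference sets (generic, for a finite abelian group given by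
-- a duplicate-free list of all its elements).  D is given as a
-- duplicate-free list; N is a decidable subset (the forbidden subgroup).

module RDS {A : Set} (G : List A) (_-_ : A → A → A) (0# : A)
           (_≟_ : DecidableEquality A) where

  diffCount : List A → A → ℕ
  diffCount D g = length (filter (λ p → (proj₁ p - proj₂ p) ≟ g) (cartesianProduct D D))

  IsRDS : (D : List A) (N : A → Set) → Decidable N → ℕ → ℕ → ℕ → ℕ → Set
  IsRDS D N N? m n k λ′ =
      length G ≡ m * n
    × length (filter N? G) ≡ n
    × length D ≡ k
    × (∀ g → ¬ N g → diffCount D g ≡ λ′)
    × (∀ g → N g → ¬ g ≡ 0# → diffCount D g ≡ 0)

Z4 : Set
Z4 = Fin 4

_+₄_ : Z4 → Z4 → Z4
a +₄ b = (toℕ a + toℕ b) mod 4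

_*₄_ : Z4 → Z4 → Z4
a *₄ b = (toℕ a * toℕ b) mod 4

neg₄ : Z4 → Z4
neg₄ a = (3 * toℕ a) mod 4

one₄ : Z4
one₄ = sucF 0F

allZ4 : List Z4
allZ4 = L.allFin 4

red₂ : Z4 → Bool
red₂ a = (toℕ a % 2) ≡ᵇ 1

-- polynomials over 𝔽₂ as coefficient lists (lowest degree first)
addP : List Bool → List Bool → List Bool
addP L.[] q = q
addP p@(_ L.∷ _) L.[] = p
addP (a L.∷ p) (b L.∷ q) = (a xor b) L.∷ addP p q

mulP : List Bool → List Bool → List Bool
mulP L.[] q = L.[]
mulP (a L.∷ p) q = addP (L.map (a ∧_) q) (false L.∷ mulP p q)

monic₂ : ∀ {d} → Vec Bool d → List Bool
monic₂ v = V.toList v L.++ L.[ true ]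

-- h(x) = x^n + Σ_{i<n} hs_i x^i over ℤ/4 is basic irreducible:
-- its reduction mod 2 (a monic polynomial of degree n ≥ 1) is irreducible
-- over 𝔽₂, i.e. is not a product of two polynomials of positive degree
-- (over 𝔽₂ every nonzero polynomial is monic).
BasicIrreducible : ∀ {n} → Vec Z4 n → Set
BasicIrreducible {n} hs =
  ¬ (Σ ℕ λ d → Σ ℕ λ e → (suc d + suc e ≡ n) ×
       Σ (Vec Bool (suc d)) λ g → Σ (Vec Bool (suc e)) λ k →
         mulP (monic₂ g) (monic₂ k) ≡ monic₂ (V.map red₂ hs))

-- The Galois ring R_n = ℤ₄[x]/(h(x)), h(x) = x^n + Σ hs_i x^i,
-- elements are coefficient vectors (a_0 , … , a_{n-1}).

shift : ∀ {A : Set} {k} → A → Vec A k → A × Vec A k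
shift z [] = z , []
shift z (x ∷ xs) with shift x xs
... | c , ys = c , (z ∷ ys)

module GR (n : ℕ) (hs : Vec Z4 n) where

  R : Set
  R = Vec Z4 n

  _≟R_ : DecidableEquality R
  _≟R_ = VP.≡-dec F._≟_

  0R : R
  0R = V.replicate n 0F

  oneV : ∀ {k} → Vec Z4 k
  oneV {zero} = []
  oneV {suc k} = one₄ ∷ V.replicate k 0F

  1R : R
  1R = oneV

  infixl 6 _+R_ _-R_
  infixl 7 _*R_

  _+R_ : R → R → R
  _+R_ = V.zipWith _+₄_

  -R_ : R → R
  -R_ = V.map neg₄

  _-R_ : R → R → R
  a -R b = a +R (-R b)

  scale : Z4 → R → R
  scale c = V.map (c *₄_)

  -- multiplication by x, using x^n = - Σ hs_i x^i
  mulX : R → R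
  mulX v with shift 0F v
  ... | c , s = s +R scale (neg₄ c) hs

  mul′ : ∀ {k} → Vec Z4 k → R → R
  mul′ [] b = 0R
  mul′ (a ∷ as) b = scale a b +R mulX (mul′ as b)

  _*R_ : R → R → R
  a *R b = mul′ a b

  pow : R → ℕ → R
  pow x zero = 1R
  pow x (suc k) = x *R pow x k

  two· : R → R
  two· r = r +R r

  allVec : (k : ℕ) → List (Vec Z4 k)
  allVec zero = L.[ [] ]
  allVec (suc k) = concatMap (λ a → L.map (a ∷_) (allVec k)) allZ4

  allR : List R
  allR = allVec n

  -- Teichmüller set Γ(R_n) = {0} ∪ (cyclic subgroup of order 2^n - 1)
  --                        = { x ∈ R_n | x^(2^n) = x }
  InΓ : R → Set
  InΓ x = pow x (2 ^ n) ≡ x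

  InΓ? : Decidable InΓ
  InΓ? x = pow x (2 ^ n) ≟R x

  Γlist : List R
  Γlist = filter InΓ? allR

  firstWith : List R → (R → Bool) → R
  firstWith L.[] p = 0R
  firstWith (y L.∷ ys) p = if p y then y else firstWith ys p

  eqb : R → R → Bool
  eqb a b with a ≟R b
  ... | yes _ = true
  ... | no _ = false

  sqrtΓ : R → R
  sqrtΓ z = firstWith Γlist (λ y → eqb (y *R y) z)

  infixl 6 _⊕_
  _⊕_ : R → R → R
  x ⊕ y = x +R y +R two· (sqrtΓ (x *R y))

  In2R : R → Set
  In2R g = Any (λ r → g ≡ two· r) allR

  In2R? : Decidable In2R
  In2R? g = any? (λ r → g ≟R two· r) allR

  InD : (R → R) → R → Set
  InD f g = Any (λ x → g ≡ x +R two· (sqrtΓ (f x))) Γlist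

  Dlist : (R → R) → List R
  Dlist f = filter (λ g → any? (λ x → g ≟R (x +R two· (sqrtΓ (f x)))) Γlist) allR

  PermΓ : (R → R) → Set
  PermΓ g =
      (∀ x → InΓ x → InΓ (g x))
    × (∀ x y → InΓ x → InΓ y → g x ≡ g y → x ≡ y)
    × (∀ y → InΓ y → ∃[ x ] (InΓ x × g x ≡ y))

  Planar : (R → R) → Set
  Planar f = ∀ ε → InΓ ε → ¬ ε ≡ 0R →
    PermΓ (λ x → f (x ⊕ ε) ⊕ f x ⊕ (ε *R x))

  open RDS allR _-R_ 0R _≟R_ public

-- Reduction mod 2 maps R_n onto R_n/2R_n ≅ 𝔽₂[x]/(h̄), a field since h̄ is irreducible; so
-- r^(2ⁿ) ≡ r (mod 2), and r ↦ r^(2ⁿ) picks the Teichmüller representative of each residue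
-- class. Every g ∈ R_n is uniquely a + 2b with a, b ∈ Γ, and for φ x = x + 2√(f x) one finds
--   φ x − φ y = a + 2b  ⟺  x = y ⊕ a  and  f (y ⊕ a) ⊕ f y ⊕ a y = b².
-- Hence g = a + 2b ∉ 2R_n is a difference of D exactly as often as b² has a preimage under
-- y ↦ f (y ⊕ a) ⊕ f y ⊕ a y, which is once for every b iff that map is a permutation; and
-- no difference lies in 2R_n ∖ {0}, since φ x − φ y ≡ x + y (mod 2) vanishes only for x = y.

module Submission where

open import Defs
open import Data.Nat using (ℕ; zero; suc; _<_; _≤_; _+_; _*_; _^_; _≤ᵇ_; s≤s; z≤n)
import Data.Nat.Properties as ℕ
open import Data.Nat.Properties
  using (≤-refl; ≤-trans; ≤-reflexive; ≤-antisym; n≤1+n; m≤m+n; +-comm; +-suc; +-identityʳ;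
         m≤n⇒m<n∨m≡n; m≤n⇒∃[o]m+o≡n)
open import Data.Fin using (toℕ) renaming (zero to 0F; suc to sucF)
open import Data.Fin.Properties using (all?; any?; _≟_)
open import Data.Bool using (Bool; true; false; _xor_; _∧_)
import Data.Bool as Bool
open import Data.Bool.Properties using (xor-assoc; xor-comm; xor-identityˡ; xor-identityʳ; xor-same; ∧-identityʳ)
open import Data.Vec as V using (Vec; []; _∷_)
import Data.Vec.Properties as VP
open import Data.Vec.Relation.Binary.Pointwise.Inductive
  using (Pointwise-≡⇒≡; zipWith-assoc; zipWith-comm; zipWith-identityˡ; zipWith-identityʳ)
open import Data.List as L using (List; []; _∷_; _++_; length; foldr; filter; cartesianProduct)
open import Data.List.Properties using (length-map; length-++; length-replicate; map-id; map-∘)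
open import Data.List.Membership.Propositional using (_∈_; find; lose)
open import Data.List.Membership.Propositional.Properties
  using (∈-∃++; ∈-++⁻; ∈-++⁺ˡ; ∈-++⁺ʳ; ∈-map⁺; ∈-map⁻; ∈-allFin; ∈-filter⁺; ∈-filter⁻;
         ∈-cartesianProductWith⁺; ∈-cartesianProduct⁺; ∈-cartesianProduct⁻)
open import Data.List.Relation.Unary.Any as Any using (Any; here; there)
import Data.List.Relation.Unary.All as All
open import Data.List.Relation.Unary.AllPairs using ([]; _∷_)
open import Data.List.Relation.Unary.Unique.Propositional using (Unique)
import Data.List.Relation.Unary.Unique.Propositional.Properties as Unique
open import Data.List.Relation.Binary.Permutation.Propositional
  using (_↭_; prep; swap; ↭-sym) renaming (refl to ↭-refl; trans to ↭-trans)
open import Data.List.Relation.Binary.Permutation.Propositional.Properties using () renaming (shift to ↭-shift)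
import Data.List.Relation.Binary.Permutation.Propositional.Properties as Perm
open import Data.Product using (∃; _×_; _,_; proj₁; proj₂)
open import Data.Sum using (_⊎_; inj₁; inj₂)
open import Data.Empty using (⊥-elim)
open import Function.Bundles using (_⇔_; mk⇔)
open import Relation.Nullary using (¬_; Dec; yes; no)
open import Relation.Nullary.Decidable using (from-yes; map′; _→-dec_)
open import Algebra.Bundles using (CommutativeRing)
open import Relation.Binary.PropositionalEquality
open ≡-Reasoning

module ℤ₄ where

  +₄-assoc : ∀ a b c → (a +₄ b) +₄ c ≡ a +₄ (b +₄ c)
  +₄-assoc = from-yes (all? λ a → all? λ b → all? λ c → (a +₄ b) +₄ c ≟ a +₄ (b +₄ c))

  +₄-comm : ∀ a b → a +₄ b ≡ b +₄ a
  +₄-comm = from-yes (all? λ a → all? λ b → a +₄ b ≟ b +₄ a)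

  +₄-identityˡ : ∀ a → 0F +₄ a ≡ a
  +₄-identityˡ = from-yes (all? λ a → 0F +₄ a ≟ a)

  +₄-inverseʳ : ∀ a → a +₄ neg₄ a ≡ 0F
  +₄-inverseʳ = from-yes (all? λ a → a +₄ neg₄ a ≟ 0F)

  *₄-assoc : ∀ a b c → (a *₄ b) *₄ c ≡ a *₄ (b *₄ c)
  *₄-assoc = from-yes (all? λ a → all? λ b → all? λ c → (a *₄ b) *₄ c ≟ a *₄ (b *₄ c))

  *₄-comm : ∀ a b → a *₄ b ≡ b *₄ a
  *₄-comm = from-yes (all? λ a → all? λ b → a *₄ b ≟ b *₄ a)

  *₄-zeroˡ : ∀ a → 0F *₄ a ≡ 0F
  *₄-zeroˡ = from-yes (all? λ a → 0F *₄ a ≟ 0F)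

  *₄-zeroʳ : ∀ a → a *₄ 0F ≡ 0F
  *₄-zeroʳ = from-yes (all? λ a → a *₄ 0F ≟ 0F)

  b*1+0≡b : ∀ b → (b *₄ one₄) +₄ 0F ≡ b
  b*1+0≡b = from-yes (all? λ b → (b *₄ one₄) +₄ 0F ≟ b)

  *₄-distribʳ-+₄ : ∀ a b c → (a +₄ b) *₄ c ≡ (a *₄ c) +₄ (b *₄ c)
  *₄-distribʳ-+₄ = from-yes (all? λ a → all? λ b → all? λ c → (a +₄ b) *₄ c ≟ (a *₄ c) +₄ (b *₄ c))

  neg₄-distribˡ-*₄ : ∀ a b → neg₄ (a *₄ b) ≡ neg₄ a *₄ b
  neg₄-distribˡ-*₄ = from-yes (all? λ a → all? λ b → neg₄ (a *₄ b) ≟ neg₄ a *₄ b)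

  neg₄-distrib-+₄ : ∀ a b → neg₄ (a +₄ b) ≡ neg₄ a +₄ neg₄ b
  neg₄-distrib-+₄ = from-yes (all? λ a → all? λ b → neg₄ (a +₄ b) ≟ neg₄ a +₄ neg₄ b)

  neg₄≡triple : ∀ a → neg₄ a ≡ (a +₄ a) +₄ a
  neg₄≡triple = from-yes (all? λ a → neg₄ a ≟ (a +₄ a) +₄ a)

  double-double₄ : ∀ a → (a +₄ a) +₄ (a +₄ a) ≡ 0F
  double-double₄ = from-yes (all? λ a → (a +₄ a) +₄ (a +₄ a) ≟ 0F)

  red₂-+₄ : ∀ a b → red₂ (a +₄ b) ≡ red₂ a xor red₂ b
  red₂-+₄ = from-yes (all? λ a → all? λ b → red₂ (a +₄ b) Bool.≟ red₂ a xor red₂ b)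

  red₂-*₄ : ∀ a b → red₂ (a *₄ b) ≡ red₂ a ∧ red₂ b
  red₂-*₄ = from-yes (all? λ a → all? λ b → red₂ (a *₄ b) Bool.≟ red₂ a ∧ red₂ b)

  red₂-neg₄ : ∀ a → red₂ (neg₄ a) ≡ red₂ a
  red₂-neg₄ = from-yes (all? λ a → red₂ (neg₄ a) Bool.≟ red₂ a)

  red₂-double : ∀ a → red₂ (a +₄ a) ≡ false
  red₂-double = from-yes (all? λ a → red₂ (a +₄ a) Bool.≟ false)

  red₂-≡⇒+double : ∀ a b → red₂ a ≡ red₂ b → ∃ λ c → b ≡ a +₄ (c +₄ c)
  red₂-≡⇒+double = from-yes (all? λ a → all? λ b →
    red₂ a Bool.≟ red₂ b →-dec any? λ c → b ≟ a +₄ (c +₄ c))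

  double₄-injective-mod2 : ∀ a b → a +₄ a ≡ b +₄ b → red₂ a ≡ red₂ b
  double₄-injective-mod2 = from-yes (all? λ a → all? λ b → a +₄ a ≟ b +₄ b →-dec red₂ a Bool.≟ red₂ b)

  highBit₄ : Z4 → Bool
  highBit₄ a = 2 ≤ᵇ toℕ a

  highBit₄-double : ∀ a → highBit₄ (a +₄ a) ≡ red₂ a
  highBit₄-double = from-yes (all? λ a → highBit₄ (a +₄ a) Bool.≟ red₂ a)

module Vectors where

  carry : {A : Set} {k : ℕ} → A → Vec A k → A
  carry z [] = z
  carry z (x ∷ xs) = carry x xs

  shiftIn : {A : Set} {k : ℕ} → A → Vec A k → Vec A k
  shiftIn z [] = []
  shiftIn z (x ∷ xs) = z ∷ shiftIn x xs

  shift≡carry,shiftIn : {A : Set} {k : ℕ} (z : A) (v : Vec A k) → shift z v ≡ (carry z v , shiftIn z v)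
  shift≡carry,shiftIn z [] = refl
  shift≡carry,shiftIn z (x ∷ xs) rewrite shift≡carry,shiftIn x xs = refl

  module _ {A B : Set} (f : A → B) where

    carry-map : ∀ {k} z (u : Vec A k) → carry (f z) (V.map f u) ≡ f (carry z u)
    carry-map z [] = refl
    carry-map z (x ∷ u) = carry-map x u

    shiftIn-map : ∀ {k} z (u : Vec A k) → shiftIn (f z) (V.map f u) ≡ V.map f (shiftIn z u)
    shiftIn-map z [] = refl
    shiftIn-map z (x ∷ u) = cong (f z ∷_) (shiftIn-map x u)

  module _ {A : Set} (f : A → A → A) where

    carry-zipWith : ∀ {k} z z′ (u v : Vec A k) → carry (f z z′) (V.zipWith f u v) ≡ f (carry z u) (carry z′ v)
    carry-zipWith z z′ [] [] = refl
    carry-zipWith z z′ (x ∷ u) (y ∷ v) = carry-zipWith x y u v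

    shiftIn-zipWith : ∀ {k} z z′ (u v : Vec A k) →
                      shiftIn (f z z′) (V.zipWith f u v) ≡ V.zipWith f (shiftIn z u) (shiftIn z′ v)
    shiftIn-zipWith z z′ [] [] = refl
    shiftIn-zipWith z z′ (x ∷ u) (y ∷ v) = cong (f z z′ ∷_) (shiftIn-zipWith x y u v)

  carry-∷ʳ : {A : Set} {k : ℕ} (d x : A) → carry d (V.replicate k d V.∷ʳ x) ≡ x
  carry-∷ʳ {k = zero} d x = refl
  carry-∷ʳ {k = suc k} d x = carry-∷ʳ {k = k} d x

  shiftIn-∷ʳ : {A : Set} {k : ℕ} (d x : A) → shiftIn d (V.replicate k d V.∷ʳ x) ≡ V.replicate (suc k) d
  shiftIn-∷ʳ {k = zero} d x = refl
  shiftIn-∷ʳ {k = suc k} d x = cong (d ∷_) (shiftIn-∷ʳ {k = k} d x)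

  pad : {A : Set} {k : ℕ} → A → List A → Vec A k
  pad {k = zero} d l = []
  pad {k = suc k} d L.[] = d ∷ pad d L.[]
  pad {k = suc k} d (c L.∷ l) = c ∷ pad d l

  pad-[] : {A : Set} {k : ℕ} (d : A) → pad {k = k} d L.[] ≡ V.replicate k d
  pad-[] {k = zero} d = refl
  pad-[] {k = suc k} d = cong (d ∷_) (pad-[] d)

  shiftIn-pad : {A : Set} {k : ℕ} (d z : A) (l : List A) → length l < k → shiftIn z (pad {k = k} d l) ≡ pad d (z L.∷ l)
  shiftIn-pad {k = suc zero} d z L.[] _ = refl
  shiftIn-pad {k = suc (suc k)} d z L.[] _ = cong (z ∷_) (shiftIn-pad d d L.[] (s≤s z≤n))
  shiftIn-pad {k = suc k} d z (c L.∷ l) (s≤s p) = cong (z ∷_) (shiftIn-pad d c l p)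

  carry-pad : {A : Set} {k : ℕ} (d z : A) (l : List A) → length l < k → carry z (pad {k = k} d l) ≡ d
  carry-pad {k = suc zero} d z L.[] _ = refl
  carry-pad {k = suc (suc k)} d z L.[] _ = carry-pad {k = suc k} d d L.[] (s≤s z≤n)
  carry-pad {k = suc k} d z (c L.∷ l) (s≤s p) = carry-pad d c l p

  pad-toList : {A : Set} {k : ℕ} (d : A) (v : Vec A k) → pad d (V.toList v) ≡ v
  pad-toList d [] = refl
  pad-toList d (x ∷ v) = cong (x ∷_) (pad-toList d v)

  pad-injective : {A : Set} {k : ℕ} (d : A) (l l′ : List A) → length l ≡ k → length l′ ≡ k →
                  pad {k = k} d l ≡ pad d l′ → l ≡ l′
  pad-injective d L.[] L.[] _ _ _ = refl
  pad-injective d L.[] (y L.∷ l′) refl () _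
  pad-injective d (x L.∷ l) L.[] refl () _
  pad-injective {k = suc k} d (x L.∷ l) (y L.∷ l′) p q eq =
    cong₂ L._∷_ (cong V.head eq) (pad-injective d l l′ (ℕ.suc-injective p) (ℕ.suc-injective q) (cong V.tail eq))

  pad-replicate-∷ʳ : {A : Set} (k : ℕ) (d x : A) → pad {k = suc k} d (L.replicate k d L.++ L.[ x ]) ≡ V.replicate k d V.∷ʳ x
  pad-replicate-∷ʳ zero d x = refl
  pad-replicate-∷ʳ (suc k) d x = cong (d ∷_) (pad-replicate-∷ʳ k d x)

  last-zipWith : ∀ {A : Set} {k} (f : A → A → A) (a b : Vec A (suc k)) → V.last (V.zipWith f a b) ≡ f (V.last a) (V.last b)
  last-zipWith {k = zero} f (x ∷ []) (y ∷ []) = refl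
  last-zipWith {k = suc k} f (x ∷ a) (y ∷ b) = last-zipWith f a b

  last-map : ∀ {A : Set} {k} (f : A → A) (a : Vec A (suc k)) → V.last (V.map f a) ≡ f (V.last a)
  last-map {k = zero} f (x ∷ []) = refl
  last-map {k = suc k} f (x ∷ a) = last-map f a

  init∷ʳlast : ∀ {A : Set} {k} (u : Vec A (suc k)) → u ≡ V.init u V.∷ʳ V.last u
  init∷ʳlast u = proj₂ (proj₂ (V.initLast u))

module Bits where

  zeros : ∀ {k} → Vec Bool k
  zeros {k} = V.replicate k false

  infixl 6 _⊻_
  _⊻_ : ∀ {k} → Vec Bool k → Vec Bool k → Vec Bool k
  _⊻_ = V.zipWith _xor_

  ⊻-assoc : ∀ {k} (a b c : Vec Bool k) → (a ⊻ b) ⊻ c ≡ a ⊻ (b ⊻ c)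
  ⊻-assoc a b c = Pointwise-≡⇒≡ (zipWith-assoc xor-assoc a b c)

  ⊻-comm : ∀ {k} (a b : Vec Bool k) → a ⊻ b ≡ b ⊻ a
  ⊻-comm a b = Pointwise-≡⇒≡ (zipWith-comm xor-comm a b)

  ⊻-identityˡ : ∀ {k} (a : Vec Bool k) → zeros ⊻ a ≡ a
  ⊻-identityˡ a = Pointwise-≡⇒≡ (zipWith-identityˡ xor-identityˡ a)

  ⊻-identityʳ : ∀ {k} (a : Vec Bool k) → a ⊻ zeros ≡ a
  ⊻-identityʳ a = Pointwise-≡⇒≡ (zipWith-identityʳ xor-identityʳ a)

  ⊻-self : ∀ {k} (a : Vec Bool k) → a ⊻ a ≡ zeros
  ⊻-self [] = refl
  ⊻-self (x ∷ a) = cong₂ _∷_ (xor-same x) (⊻-self a)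

  ⊻-cancelʳ : ∀ {k} (a b : Vec Bool k) → (a ⊻ b) ⊻ b ≡ a
  ⊻-cancelʳ a b = begin
    (a ⊻ b) ⊻ b ≡⟨ ⊻-assoc a b b ⟩
    a ⊻ (b ⊻ b) ≡⟨ cong (a ⊻_) (⊻-self b) ⟩
    a ⊻ zeros   ≡⟨ ⊻-identityʳ a ⟩
    a           ∎

  ⊻≡zeros⇒≡ : ∀ {k} (a b : Vec Bool k) → a ⊻ b ≡ zeros → a ≡ b
  ⊻≡zeros⇒≡ a b e = begin
    a                ≡⟨ sym (⊻-cancelʳ a b) ⟩
    (a ⊻ b) ⊻ b      ≡⟨ cong (_⊻ b) e ⟩
    zeros ⊻ b        ≡⟨ ⊻-identityˡ b ⟩
    b                ∎

  allBits : ∀ k → List (Vec Bool k)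
  allBits zero = [] ∷ []
  allBits (suc k) = L.map (true ∷_) (allBits k) ++ L.map (false ∷_) (allBits k)

  nonzeroBits : ∀ k → List (Vec Bool k)
  nonzeroBits zero = []
  nonzeroBits (suc k) = L.map (true ∷_) (allBits k) ++ L.map (false ∷_) (nonzeroBits k)

  ∈-allBits : ∀ {k} (v : Vec Bool k) → v ∈ allBits k
  ∈-allBits [] = here refl
  ∈-allBits (true ∷ v) = ∈-++⁺ˡ (∈-map⁺ (true ∷_) (∈-allBits v))
  ∈-allBits (false ∷ v) = ∈-++⁺ʳ _ (∈-map⁺ (false ∷_) (∈-allBits v))

  ∈-nonzeroBits : ∀ {k} (v : Vec Bool k) → v ≢ zeros → v ∈ nonzeroBits k
  ∈-nonzeroBits [] v≢0 = ⊥-elim (v≢0 refl)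
  ∈-nonzeroBits (true ∷ v) v≢0 = ∈-++⁺ˡ (∈-map⁺ (true ∷_) (∈-allBits v))
  ∈-nonzeroBits (false ∷ v) v≢0 = ∈-++⁺ʳ _ (∈-map⁺ (false ∷_) (∈-nonzeroBits v (λ e → v≢0 (cong (false ∷_) e))))

  nonzeroBits-nonzero : ∀ {k} {v : Vec Bool k} → v ∈ nonzeroBits k → v ≢ zeros
  nonzeroBits-nonzero {suc k} v∈ with ∈-++⁻ (L.map (true ∷_) (allBits k)) v∈
  ... | inj₁ p with ∈-map⁻ (true ∷_) p
  ...   | _ , _ , refl = λ ()
  nonzeroBits-nonzero {suc k} v∈ | inj₂ q with ∈-map⁻ (false ∷_) q
  ...   | u , u∈ , refl = λ e → nonzeroBits-nonzero u∈ (cong V.tail e)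

  private
    ∷-injective : ∀ {k} {c} {u v : Vec Bool k} → c ∷ u ≡ c ∷ v → u ≡ v
    ∷-injective refl = refl

    disjoint : ∀ {k} (xs ys : List (Vec Bool k)) {v} → ¬ (v ∈ L.map (true ∷_) xs × v ∈ L.map (false ∷_) ys)
    disjoint xs ys (p , q) with ∈-map⁻ (true ∷_) p | ∈-map⁻ (false ∷_) q
    ... | _ , _ , refl | _ , _ , ()

  allBits-unique : ∀ k → Unique (allBits k)
  allBits-unique zero = All.[] ∷ []
  allBits-unique (suc k) =
    Unique.++⁺ (Unique.map⁺ ∷-injective (allBits-unique k)) (Unique.map⁺ ∷-injective (allBits-unique k)) (disjoint _ _)

  nonzeroBits-unique : ∀ k → Unique (nonzeroBits k)
  nonzeroBits-unique zero = []
  nonzeroBits-unique (suc k) =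
    Unique.++⁺ (Unique.map⁺ ∷-injective (allBits-unique k)) (Unique.map⁺ ∷-injective (nonzeroBits-unique k)) (disjoint _ _)

  length-allBits : ∀ k → length (allBits k) ≡ 2 ^ k
  length-allBits zero = refl
  length-allBits (suc k) = begin
    length (L.map (true ∷_) (allBits k) ++ L.map (false ∷_) (allBits k))
      ≡⟨ length-++ (L.map (true ∷_) (allBits k)) ⟩
    length (L.map (true ∷_) (allBits k)) + length (L.map (false ∷_) (allBits k))
      ≡⟨ cong₂ _+_ (length-map _ (allBits k)) (length-map _ (allBits k)) ⟩
    length (allBits k) + length (allBits k)
      ≡⟨ cong₂ _+_ (length-allBits k) (trans (length-allBits k) (sym (+-identityʳ (2 ^ k)))) ⟩
    2 ^ suc k ∎

  suc-length-nonzeroBits : ∀ k → suc (length (nonzeroBits k)) ≡ 2 ^ k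
  suc-length-nonzeroBits zero = refl
  suc-length-nonzeroBits (suc k) = begin
    suc (length (L.map (true ∷_) (allBits k) ++ L.map (false ∷_) (nonzeroBits k)))
      ≡⟨ cong suc (length-++ (L.map (true ∷_) (allBits k))) ⟩
    suc (length (L.map (true ∷_) (allBits k)) + length (L.map (false ∷_) (nonzeroBits k)))
      ≡⟨ cong suc (cong₂ _+_ (length-map _ (allBits k)) (length-map _ (nonzeroBits k))) ⟩
    suc (length (allBits k) + length (nonzeroBits k))
      ≡⟨ sym (+-suc _ _) ⟩
    length (allBits k) + suc (length (nonzeroBits k))
      ≡⟨ cong₂ _+_ (length-allBits k) (trans (suc-length-nonzeroBits k) (sym (+-identityʳ (2 ^ k)))) ⟩
    2 ^ suc k ∎

  any?-Bits : ∀ d {Q : Vec Bool d → Set} → (∀ v → Dec (Q v)) → Dec (∃ Q)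
  any?-Bits d {Q} Q? = map′ witness (λ (v , q) → lose (∈-allBits v) q)
                        (Any.any? Q? (allBits d))
    where
    witness : Any.Any Q (allBits d) → ∃ Q
    witness a with find a
    ... | v , _ , q = v , q

module Counting where

  private
    variable A B : Set

    ∈-remove : ∀ {x z : A} (xs ys : List A) → z ∈ xs ++ x ∷ ys → z ≢ x → z ∈ xs ++ ys
    ∈-remove xs ys z∈ z≢x with ∈-++⁻ xs z∈
    ... | inj₁ p = ∈-++⁺ˡ p
    ... | inj₂ (here eq) = ⊥-elim (z≢x eq)
    ... | inj₂ (there p) = ∈-++⁺ʳ xs p

    length-middle : ∀ (xs ys : List A) x → length (xs ++ x ∷ ys) ≡ suc (length (xs ++ ys))
    length-middle [] ys x = refl
    length-middle (y ∷ xs) ys x = cong suc (length-middle xs ys x)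

  unique-⊆⇒length≤ : ∀ {xs ys : List A} → Unique xs → (∀ {x} → x ∈ xs → x ∈ ys) → length xs ≤ length ys
  unique-⊆⇒length≤ {xs = []} _ _ = z≤n
  unique-⊆⇒length≤ {xs = x ∷ xs} (x∉xs ∷ u) ⊆ with ∈-∃++ (⊆ (here refl))
  ... | ys₁ , ys₂ , refl = ≤-trans (s≤s (unique-⊆⇒length≤ u ⊆′)) (≤-reflexive (sym (length-middle ys₁ ys₂ x)))
    where
    ⊆′ : ∀ {z} → z ∈ xs → z ∈ ys₁ ++ ys₂
    ⊆′ z∈ = ∈-remove ys₁ ys₂ (⊆ (there z∈)) (λ eq → All.lookup x∉xs z∈ (sym eq))

  unique-⊆⇒↭ : ∀ {xs ys : List A} → Unique xs → (∀ {x} → x ∈ xs → x ∈ ys) → length ys ≤ length xs → xs ↭ ys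
  unique-⊆⇒↭ {xs = []} {[]} _ _ _ = ↭-refl
  unique-⊆⇒↭ {xs = x ∷ xs} (x∉xs ∷ u) ⊆ ys≤xs with ∈-∃++ (⊆ (here refl))
  ... | ys₁ , ys₂ , refl = ↭-trans (prep x (unique-⊆⇒↭ u ⊆′ ≤′)) (↭-sym (↭-shift x ys₁ ys₂))
    where
    ⊆′ : ∀ {z} → z ∈ xs → z ∈ ys₁ ++ ys₂
    ⊆′ z∈ = ∈-remove ys₁ ys₂ (⊆ (there z∈)) (λ eq → All.lookup x∉xs z∈ (sym eq))
    ≤′ : length (ys₁ ++ ys₂) ≤ length xs
    ≤′ with ≤-trans (≤-reflexive (sym (length-middle ys₁ ys₂ x))) ys≤xs
    ... | s≤s p = p

  map⁺-injectiveOn : (f : A → B) {xs : List A} → Unique xs →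
                     (∀ {x y} → x ∈ xs → y ∈ xs → f x ≡ f y → x ≡ y) → Unique (L.map f xs)
  map⁺-injectiveOn f {xs = []} _ _ = []
  map⁺-injectiveOn f {xs = x ∷ xs} (x∉xs ∷ u) inj =
    All.tabulate fresh ∷ map⁺-injectiveOn f u (λ p q → inj (there p) (there q))
    where
    fresh : ∀ {z} → z ∈ L.map f xs → f x ≢ z
    fresh z∈ fx≡z with ∈-map⁻ f z∈
    ... | y , y∈ , refl = All.lookup x∉xs y∈ (inj (here refl) (there y∈) fx≡z)

  injection⇒length≤ : ∀ {xs : List A} {ys : List B} → Unique xs → (f : A → B) →
                      (∀ {x} → x ∈ xs → f x ∈ ys) → (∀ {x y} → x ∈ xs → y ∈ xs → f x ≡ f y → x ≡ y) →
                      length xs ≤ length ys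
  injection⇒length≤ {xs = xs} {ys} u f f∈ inj =
    ≤-trans (≤-reflexive (sym (length-map f xs))) (unique-⊆⇒length≤ (map⁺-injectiveOn f u inj) ⊆)
    where
    ⊆ : ∀ {z} → z ∈ L.map f xs → z ∈ ys
    ⊆ z∈ with ∈-map⁻ f z∈
    ... | x , x∈ , refl = f∈ x∈

  foldr-↭ : {A B : Set} (f : A → B → B) (e : B) → (∀ x y z → f x (f y z) ≡ f y (f x z)) →
            ∀ {xs ys} → xs ↭ ys → foldr f e xs ≡ foldr f e ys
  foldr-↭ f e lc ↭-refl = refl
  foldr-↭ f e lc (prep x p) = cong (f x) (foldr-↭ f e lc p)
  foldr-↭ f e lc (swap x y p) = trans (lc x y _) (cong (λ t → f y (f x t)) (foldr-↭ f e lc p))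
  foldr-↭ f e lc (↭-trans p q) = trans (foldr-↭ f e lc p) (foldr-↭ f e lc q)

  length-cartesianProductWith : ∀ {A B C : Set} (f : A → B → C) xs ys →
                                length (L.cartesianProductWith f xs ys) ≡ length xs * length ys
  length-cartesianProductWith f L.[] ys = refl
  length-cartesianProductWith f (x L.∷ xs) ys = begin
    length (L.map (f x) ys L.++ L.cartesianProductWith f xs ys)
      ≡⟨ length-++ (L.map (f x) ys) ⟩
    length (L.map (f x) ys) + length (L.cartesianProductWith f xs ys)
      ≡⟨ cong₂ _+_ (length-map (f x) ys) (length-cartesianProductWith f xs ys) ⟩
    length ys + length xs * length ys                                     ∎

  length≡1 : ∀ {xs : List A} {x} → Unique xs → x ∈ xs → (∀ {y} → y ∈ xs → y ≡ x) → length xs ≡ 1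
  length≡1 {xs = _ ∷ []} _ _ _ = refl
  length≡1 {xs = _ ∷ _ ∷ _} ((y≢z All.∷ _) ∷ _) _ all = ⊥-elim (y≢z (trans (all (here refl)) (sym (all (there (here refl))))))

  length≡1⇒∈⇒≡ : ∀ (xs : List A) → length xs ≡ 1 → ∀ {x y} → x ∈ xs → y ∈ xs → x ≡ y
  length≡1⇒∈⇒≡ (_ ∷ []) _ (here refl) (here refl) = refl

  length≡1⇒nonempty : ∀ (xs : List A) → length xs ≡ 1 → ∃ λ x → x ∈ xs
  length≡1⇒nonempty (x ∷ []) _ = x , here refl

  length≡0 : ∀ (xs : List A) → (∀ {x} → ¬ x ∈ xs) → length xs ≡ 0
  length≡0 [] _ = refl
  length≡0 (x ∷ xs) ∉ = ⊥-elim (∉ (here refl))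

leastBelow : (P : ℕ → Set) → (∀ k → Dec (P k)) → ∀ N →
  (∃ λ d → d < N × P d × (∀ d′ → d′ < d → ¬ P d′)) ⊎ (∀ d′ → d′ < N → ¬ P d′)
leastBelow P P? zero = inj₂ λ _ ()
leastBelow P P? (suc N) with leastBelow P P? N
... | inj₁ (d , d<N , p , below) = inj₁ (d , ≤-trans d<N (n≤1+n N) , p , below)
... | inj₂ none with P? N
...   | yes p = inj₁ (N , ≤-refl , p , none)
...   | no ¬p = inj₂ none′
  where
  none′ : ∀ d′ → d′ < suc N → ¬ P d′
  none′ d′ (s≤s d′≤N) with m≤n⇒m<n∨m≡n d′≤N
  ... | inj₁ d′<N = none d′ d′<N
  ... | inj₂ refl = ¬p

module BinaryPolynomials where

  addP-[] : ∀ l → addP l L.[] ≡ l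
  addP-[] L.[] = refl
  addP-[] (x L.∷ l) = refl

  addP-∷ʳ : ∀ p q t → length p ≤ length q → addP p (q ++ L.[ t ]) ≡ addP p q ++ L.[ t ]
  addP-∷ʳ L.[] q t _ = refl
  addP-∷ʳ (x L.∷ p) (y L.∷ q) t (s≤s le) = cong ((x xor y) L.∷_) (addP-∷ʳ p q t le)

  length-addP : ∀ p q → length p ≤ length q → length (addP p q) ≡ length q
  length-addP L.[] q _ = refl
  length-addP (x L.∷ p) (y L.∷ q) (s≤s le) = cong suc (length-addP p q le)

  mulP-monic : ∀ p q → ∃ λ c →
    (mulP (p ++ L.[ true ]) (q ++ L.[ true ]) ≡ c ++ L.[ true ]) × (length c ≡ length p + length q)
  mulP-monic L.[] q = q , 1*q , refl
    where
    +0 : ∀ l → addP (l ++ L.[ true ]) L.[ false ] ≡ l ++ L.[ true ]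
    +0 L.[] = refl
    +0 (y L.∷ l) = cong₂ L._∷_ (xor-identityʳ y) (addP-[] _)
    1*q : addP (L.map (true ∧_) (q ++ L.[ true ])) L.[ false ] ≡ q ++ L.[ true ]
    1*q = trans (cong (λ l → addP l L.[ false ]) (map-id (q ++ L.[ true ]))) (+0 q)
  mulP-monic (a L.∷ p) q with mulP-monic p q
  ... | c , eq , len = addP aq (false L.∷ c) , prod , len′
    where
    aq = L.map (a ∧_) (q ++ L.[ true ])
    length-aq : length aq ≡ suc (length q)
    length-aq = trans (length-map (a ∧_) (q ++ L.[ true ])) (trans (length-++ q) (+-comm (length q) 1))
    aq≤ : length aq ≤ length (false L.∷ c)
    aq≤ = ≤-trans (≤-reflexive length-aq) (s≤s (≤-trans (m≤m+n (length q) (length p))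
            (≤-reflexive (trans (+-comm (length q) (length p)) (sym len)))))
    prod : addP aq (false L.∷ mulP (p ++ L.[ true ]) (q ++ L.[ true ])) ≡ addP aq (false L.∷ c) ++ L.[ true ]
    prod rewrite eq = addP-∷ʳ aq (false L.∷ c) true aq≤
    len′ : length (addP aq (false L.∷ c)) ≡ suc (length p + length q)
    len′ = trans (length-addP aq (false L.∷ c) aq≤) (cong suc len)

module GaloisRing (n : ℕ) (hs : Vec Z4 n) where

  open ℤ₄
  open Vectors
  open GR n hs

  infixl 6 _⊞_
  _⊞_ : ∀ {k} → Vec Z4 k → Vec Z4 k → Vec Z4 k
  _⊞_ = V.zipWith _+₄_

  zs : ∀ {k} → Vec Z4 k
  zs {k} = V.replicate k 0F

  infixr 7 _·_
  _·_ : ∀ {k} → Z4 → Vec Z4 k → Vec Z4 k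
  c · v = V.map (c *₄_) v

  ⊞-assoc : ∀ {k} (a b c : Vec Z4 k) → (a ⊞ b) ⊞ c ≡ a ⊞ (b ⊞ c)
  ⊞-assoc a b c = Pointwise-≡⇒≡ (zipWith-assoc +₄-assoc a b c)

  ⊞-comm : ∀ {k} (a b : Vec Z4 k) → a ⊞ b ≡ b ⊞ a
  ⊞-comm a b = Pointwise-≡⇒≡ (zipWith-comm +₄-comm a b)

  ⊞-identityˡ : ∀ {k} (a : Vec Z4 k) → zs ⊞ a ≡ a
  ⊞-identityˡ a = Pointwise-≡⇒≡ (zipWith-identityˡ +₄-identityˡ a)

  ⊞-identityʳ : ∀ {k} (a : Vec Z4 k) → a ⊞ zs ≡ a
  ⊞-identityʳ a = trans (⊞-comm a zs) (⊞-identityˡ a)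

  ⊞-inverseʳ : ∀ {k} (a : Vec Z4 k) → a ⊞ V.map neg₄ a ≡ zs
  ⊞-inverseʳ [] = refl
  ⊞-inverseʳ (x ∷ a) = cong₂ _∷_ (+₄-inverseʳ x) (⊞-inverseʳ a)

  ⊞-inverseˡ : ∀ {k} (a : Vec Z4 k) → V.map neg₄ a ⊞ a ≡ zs
  ⊞-inverseˡ a = trans (⊞-comm (V.map neg₄ a) a) (⊞-inverseʳ a)

  ⊞-interchange : ∀ {k} (a b c d : Vec Z4 k) → (a ⊞ b) ⊞ (c ⊞ d) ≡ (a ⊞ c) ⊞ (b ⊞ d)
  ⊞-interchange a b c d = begin
    (a ⊞ b) ⊞ (c ⊞ d) ≡⟨ ⊞-assoc a b (c ⊞ d) ⟩
    a ⊞ (b ⊞ (c ⊞ d)) ≡⟨ cong (a ⊞_) (sym (⊞-assoc b c d)) ⟩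
    a ⊞ ((b ⊞ c) ⊞ d) ≡⟨ cong (λ t → a ⊞ (t ⊞ d)) (⊞-comm b c) ⟩
    a ⊞ ((c ⊞ b) ⊞ d) ≡⟨ cong (a ⊞_) (⊞-assoc c b d) ⟩
    a ⊞ (c ⊞ (b ⊞ d)) ≡⟨ sym (⊞-assoc a c (b ⊞ d)) ⟩
    (a ⊞ c) ⊞ (b ⊞ d) ∎

  double-double : ∀ {k} (c : Vec Z4 k) → (c ⊞ c) ⊞ (c ⊞ c) ≡ zs
  double-double [] = refl
  double-double (x ∷ c) = cong₂ _∷_ (double-double₄ x) (double-double c)

  neg≡triple : ∀ {k} (u : Vec Z4 k) → V.map neg₄ u ≡ (u ⊞ u) ⊞ u
  neg≡triple [] = refl
  neg≡triple (x ∷ u) = cong₂ _∷_ (neg₄≡triple x) (neg≡triple u)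

  ·-distribˡ-⊞ : ∀ {k} c (a b : Vec Z4 k) → c · (a ⊞ b) ≡ c · a ⊞ c · b
  ·-distribˡ-⊞ c [] [] = refl
  ·-distribˡ-⊞ c (x ∷ a) (y ∷ b) = cong₂ _∷_ distrib (·-distribˡ-⊞ c a b)
    where
    distrib : c *₄ (x +₄ y) ≡ (c *₄ x) +₄ (c *₄ y)
    distrib = begin
      c *₄ (x +₄ y)          ≡⟨ *₄-comm c (x +₄ y) ⟩
      (x +₄ y) *₄ c          ≡⟨ *₄-distribʳ-+₄ x y c ⟩
      (x *₄ c) +₄ (y *₄ c)   ≡⟨ cong₂ _+₄_ (*₄-comm x c) (*₄-comm y c) ⟩
      (c *₄ x) +₄ (c *₄ y)   ∎

  ·-distribʳ-+₄ : ∀ {k} c d (a : Vec Z4 k) → (c +₄ d) · a ≡ c · a ⊞ d · a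
  ·-distribʳ-+₄ c d [] = refl
  ·-distribʳ-+₄ c d (x ∷ a) = cong₂ _∷_ (*₄-distribʳ-+₄ c d x) (·-distribʳ-+₄ c d a)

  ·-assoc : ∀ {k} c d (a : Vec Z4 k) → c · d · a ≡ (c *₄ d) · a
  ·-assoc c d [] = refl
  ·-assoc c d (x ∷ a) = cong₂ _∷_ (sym (*₄-assoc c d x)) (·-assoc c d a)

  ·-comm : ∀ {k} c d (a : Vec Z4 k) → c · d · a ≡ d · c · a
  ·-comm c d a = begin
    c · d · a     ≡⟨ ·-assoc c d a ⟩
    (c *₄ d) · a  ≡⟨ cong (_· a) (*₄-comm c d) ⟩
    (d *₄ c) · a  ≡⟨ sym (·-assoc d c a) ⟩
    d · c · a     ∎

  0·a≡zs : ∀ {k} (a : Vec Z4 k) → 0F · a ≡ zs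
  0·a≡zs [] = refl
  0·a≡zs (x ∷ a) = cong₂ _∷_ (*₄-zeroˡ x) (0·a≡zs a)

  c·zs≡zs : ∀ {k} c → c · zs {k} ≡ zs
  c·zs≡zs {zero} c = refl
  c·zs≡zs {suc k} c = cong₂ _∷_ (*₄-zeroʳ c) (c·zs≡zs c)

  mulX≡shiftIn+carry·hs : ∀ v → mulX v ≡ shiftIn 0F v ⊞ neg₄ (carry 0F v) · hs
  mulX≡shiftIn+carry·hs v rewrite shift≡carry,shiftIn 0F v = refl

  mulX-⊞ : ∀ u v → mulX (u ⊞ v) ≡ mulX u ⊞ mulX v
  mulX-⊞ u v = begin
    mulX (u ⊞ v)
      ≡⟨ mulX≡shiftIn+carry·hs (u ⊞ v) ⟩
    shiftIn (0F +₄ 0F) (u ⊞ v) ⊞ neg₄ (carry (0F +₄ 0F) (u ⊞ v)) · hs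
      ≡⟨ cong₂ (λ p q → p ⊞ neg₄ q · hs) (shiftIn-zipWith _+₄_ 0F 0F u v) (carry-zipWith _+₄_ 0F 0F u v) ⟩
    (shiftIn 0F u ⊞ shiftIn 0F v) ⊞ neg₄ (cu +₄ cv) · hs
      ≡⟨ cong (λ t → (shiftIn 0F u ⊞ shiftIn 0F v) ⊞ t · hs) (neg₄-distrib-+₄ cu cv) ⟩
    (shiftIn 0F u ⊞ shiftIn 0F v) ⊞ (neg₄ cu +₄ neg₄ cv) · hs
      ≡⟨ cong ((shiftIn 0F u ⊞ shiftIn 0F v) ⊞_) (·-distribʳ-+₄ (neg₄ cu) (neg₄ cv) hs) ⟩
    (shiftIn 0F u ⊞ shiftIn 0F v) ⊞ (neg₄ cu · hs ⊞ neg₄ cv · hs)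
      ≡⟨ ⊞-interchange _ _ _ _ ⟩
    (shiftIn 0F u ⊞ neg₄ cu · hs) ⊞ (shiftIn 0F v ⊞ neg₄ cv · hs)
      ≡⟨ sym (cong₂ _⊞_ (mulX≡shiftIn+carry·hs u) (mulX≡shiftIn+carry·hs v)) ⟩
    mulX u ⊞ mulX v ∎
    where
    cu = carry 0F u
    cv = carry 0F v

  mulX-· : ∀ c u → mulX (c · u) ≡ c · mulX u
  mulX-· c u = begin
    mulX (c · u)
      ≡⟨ mulX≡shiftIn+carry·hs (c · u) ⟩
    shiftIn 0F (c · u) ⊞ neg₄ (carry 0F (c · u)) · hs
      ≡⟨ cong₂ (λ z w → shiftIn z (c · u) ⊞ neg₄ (carry w (c · u)) · hs) (sym (*₄-zeroʳ c)) (sym (*₄-zeroʳ c)) ⟩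
    shiftIn (c *₄ 0F) (c · u) ⊞ neg₄ (carry (c *₄ 0F) (c · u)) · hs
      ≡⟨ cong₂ (λ p q → p ⊞ neg₄ q · hs) (shiftIn-map (c *₄_) 0F u) (carry-map (c *₄_) 0F u) ⟩
    c · shiftIn 0F u ⊞ neg₄ (c *₄ cu) · hs
      ≡⟨ cong (λ t → c · shiftIn 0F u ⊞ t · hs) neg-c*cu ⟩
    c · shiftIn 0F u ⊞ (c *₄ neg₄ cu) · hs
      ≡⟨ cong (c · shiftIn 0F u ⊞_) (sym (·-assoc c (neg₄ cu) hs)) ⟩
    c · shiftIn 0F u ⊞ c · neg₄ cu · hs
      ≡⟨ sym (·-distribˡ-⊞ c _ _) ⟩
    c · (shiftIn 0F u ⊞ neg₄ cu · hs)
      ≡⟨ cong (c ·_) (sym (mulX≡shiftIn+carry·hs u)) ⟩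
    c · mulX u ∎
    where
    cu = carry 0F u
    neg-c*cu : neg₄ (c *₄ cu) ≡ c *₄ neg₄ cu
    neg-c*cu = begin
      neg₄ (c *₄ cu)  ≡⟨ cong neg₄ (*₄-comm c cu) ⟩
      neg₄ (cu *₄ c)  ≡⟨ neg₄-distribˡ-*₄ cu c ⟩
      neg₄ cu *₄ c    ≡⟨ *₄-comm (neg₄ cu) c ⟩
      c *₄ neg₄ cu    ∎

  mulX-zs : mulX 0R ≡ 0R
  mulX-zs = begin
    mulX 0R         ≡⟨ cong mulX (sym (0·a≡zs 0R)) ⟩
    mulX (0F · 0R)  ≡⟨ mulX-· 0F 0R ⟩
    0F · mulX 0R    ≡⟨ 0·a≡zs _ ⟩
    0R              ∎

  mul′-⊞ˡ : ∀ {k} (a a′ : Vec Z4 k) b → mul′ (a ⊞ a′) b ≡ mul′ a b ⊞ mul′ a′ b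
  mul′-⊞ˡ [] [] b = sym (⊞-identityˡ 0R)
  mul′-⊞ˡ (x ∷ a) (y ∷ a′) b = begin
    (x +₄ y) · b ⊞ mulX (mul′ (a ⊞ a′) b)
      ≡⟨ cong₂ _⊞_ (·-distribʳ-+₄ x y b) (trans (cong mulX (mul′-⊞ˡ a a′ b)) (mulX-⊞ (mul′ a b) (mul′ a′ b))) ⟩
    (x · b ⊞ y · b) ⊞ (mulX (mul′ a b) ⊞ mulX (mul′ a′ b))
      ≡⟨ ⊞-interchange _ _ _ _ ⟩
    (x · b ⊞ mulX (mul′ a b)) ⊞ (y · b ⊞ mulX (mul′ a′ b)) ∎

  mul′-⊞ʳ : ∀ {k} (a : Vec Z4 k) b b′ → mul′ a (b ⊞ b′) ≡ mul′ a b ⊞ mul′ a b′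
  mul′-⊞ʳ [] b b′ = sym (⊞-identityˡ 0R)
  mul′-⊞ʳ (x ∷ a) b b′ = begin
    x · (b ⊞ b′) ⊞ mulX (mul′ a (b ⊞ b′))
      ≡⟨ cong₂ _⊞_ (·-distribˡ-⊞ x b b′) (trans (cong mulX (mul′-⊞ʳ a b b′)) (mulX-⊞ (mul′ a b) (mul′ a b′))) ⟩
    (x · b ⊞ x · b′) ⊞ (mulX (mul′ a b) ⊞ mulX (mul′ a b′))
      ≡⟨ ⊞-interchange _ _ _ _ ⟩
    (x · b ⊞ mulX (mul′ a b)) ⊞ (x · b′ ⊞ mulX (mul′ a b′)) ∎

  mul′-·ʳ : ∀ {k} (a : Vec Z4 k) c b → mul′ a (c · b) ≡ c · mul′ a b
  mul′-·ʳ [] c b = sym (c·zs≡zs c)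
  mul′-·ʳ (x ∷ a) c b = begin
    x · c · b ⊞ mulX (mul′ a (c · b))
      ≡⟨ cong₂ _⊞_ (·-comm x c b) (trans (cong mulX (mul′-·ʳ a c b)) (mulX-· c (mul′ a b))) ⟩
    c · x · b ⊞ c · mulX (mul′ a b)
      ≡⟨ sym (·-distribˡ-⊞ c _ _) ⟩
    c · (x · b ⊞ mulX (mul′ a b)) ∎

  mul′-·ˡ : ∀ {k} c (a : Vec Z4 k) b → mul′ (c · a) b ≡ c · mul′ a b
  mul′-·ˡ c [] b = sym (c·zs≡zs c)
  mul′-·ˡ c (x ∷ a) b = begin
    (c *₄ x) · b ⊞ mulX (mul′ (c · a) b)
      ≡⟨ cong₂ _⊞_ (sym (·-assoc c x b)) (trans (cong mulX (mul′-·ˡ c a b)) (mulX-· c (mul′ a b))) ⟩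
    c · x · b ⊞ c · mulX (mul′ a b)
      ≡⟨ sym (·-distribˡ-⊞ c _ _) ⟩
    c · (x · b ⊞ mulX (mul′ a b)) ∎

  mul′-mulX : ∀ {k} (a : Vec Z4 k) b → mul′ a (mulX b) ≡ mulX (mul′ a b)
  mul′-mulX [] b = sym mulX-zs
  mul′-mulX (x ∷ a) b = begin
    x · mulX b ⊞ mulX (mul′ a (mulX b))
      ≡⟨ cong₂ _⊞_ (sym (mulX-· x b)) (cong mulX (mul′-mulX a b)) ⟩
    mulX (x · b) ⊞ mulX (mulX (mul′ a b))
      ≡⟨ sym (mulX-⊞ (x · b) (mulX (mul′ a b))) ⟩
    mulX (x · b ⊞ mulX (mul′ a b)) ∎

  mul′-zsʳ : ∀ {k} (a : Vec Z4 k) → mul′ a 0R ≡ 0R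
  mul′-zsʳ a = begin
    mul′ a 0R         ≡⟨ cong (mul′ a) (sym (0·a≡zs 0R)) ⟩
    mul′ a (0F · 0R)  ≡⟨ mul′-·ʳ a 0F 0R ⟩
    0F · mul′ a 0R    ≡⟨ 0·a≡zs _ ⟩
    0R                ∎

  mul′-zsˡ : ∀ {k} b → mul′ (zs {k}) b ≡ 0R
  mul′-zsˡ {k} b = begin
    mul′ (zs {k}) b         ≡⟨ cong (λ t → mul′ t b) (sym (0·a≡zs (zs {k}))) ⟩
    mul′ (0F · zs {k}) b    ≡⟨ mul′-·ˡ 0F (zs {k}) b ⟩
    0F · mul′ (zs {k}) b    ≡⟨ 0·a≡zs _ ⟩
    0R                 ∎

  -- a coefficient vector (of length at most n) read as an element of R
  embed : ∀ {k} → Vec Z4 k → R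
  embed c = mul′ c 1R

  mul′-embed-comm : ∀ {k l} (a : Vec Z4 k) (c : Vec Z4 l) → mul′ a (embed c) ≡ mul′ c (embed a)
  mul′-embed-comm [] c = sym (mul′-zsʳ c)
  mul′-embed-comm (x ∷ a) c = begin
    x · embed c ⊞ mulX (mul′ a (embed c))
      ≡⟨ cong₂ _⊞_ (sym (mul′-·ʳ c x 1R)) (cong mulX (mul′-embed-comm a c)) ⟩
    mul′ c (x · 1R) ⊞ mulX (mul′ c (embed a))
      ≡⟨ cong (mul′ c (x · 1R) ⊞_) (sym (mul′-mulX c (embed a))) ⟩
    mul′ c (x · 1R) ⊞ mul′ c (mulX (embed a))
      ≡⟨ sym (mul′-⊞ʳ c _ _) ⟩
    mul′ c (x · 1R ⊞ mulX (embed a)) ∎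

  mulX-pad : (l : List Z4) → length l < n → mulX (pad 0F l) ≡ pad 0F (0F L.∷ l)
  mulX-pad l l<n = begin
    mulX (pad 0F l)
      ≡⟨ mulX≡shiftIn+carry·hs (pad 0F l) ⟩
    shiftIn 0F (pad 0F l) ⊞ neg₄ (carry 0F (pad {k = n} 0F l)) · hs
      ≡⟨ cong₂ (λ p q → p ⊞ neg₄ q · hs) (shiftIn-pad 0F 0F l l<n) (carry-pad 0F 0F l l<n) ⟩
    pad 0F (0F L.∷ l) ⊞ 0F · hs
      ≡⟨ cong (pad 0F (0F L.∷ l) ⊞_) (0·a≡zs hs) ⟩
    pad 0F (0F L.∷ l) ⊞ zs
      ≡⟨ ⊞-identityʳ _ ⟩
    pad 0F (0F L.∷ l) ∎

  ·oneV⊞pad : ∀ {k} b (l : List Z4) → b · oneV {k} ⊞ pad 0F (0F L.∷ l) ≡ pad 0F (b L.∷ l)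
  ·oneV⊞pad {zero} b l = refl
  ·oneV⊞pad {suc k} b l = cong₂ _∷_ (b*1+0≡b b) (begin
    b · zs ⊞ pad 0F l  ≡⟨ cong (_⊞ pad 0F l) (c·zs≡zs b) ⟩
    zs ⊞ pad 0F l      ≡⟨ ⊞-identityˡ _ ⟩
    pad 0F l           ∎)

  embed≡pad : ∀ {k} (bs : Vec Z4 k) → k ≤ n → embed bs ≡ pad 0F (V.toList bs)
  embed≡pad [] _ = sym (pad-[] 0F)
  embed≡pad {suc k} (b ∷ bs) k<n = begin
    b · 1R ⊞ mulX (embed bs)
      ≡⟨ cong (λ t → b · 1R ⊞ mulX t) (embed≡pad bs (≤-trans (n≤1+n k) k<n)) ⟩
    b · 1R ⊞ mulX (pad 0F (V.toList bs))
      ≡⟨ cong (b · 1R ⊞_) (mulX-pad (V.toList bs) (subst (_< n) (sym (VP.length-toList bs)) k<n)) ⟩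
    b · 1R ⊞ pad 0F (0F L.∷ V.toList bs)
      ≡⟨ ·oneV⊞pad b (V.toList bs) ⟩
    pad 0F (b L.∷ V.toList bs) ∎

  *-identityʳ : ∀ a → a *R 1R ≡ a
  *-identityʳ a = trans (embed≡pad a ≤-refl) (pad-toList 0F a)

  *-comm : ∀ a b → a *R b ≡ b *R a
  *-comm a b = begin
    mul′ a b          ≡⟨ cong (mul′ a) (sym (*-identityʳ b)) ⟩
    mul′ a (embed b)  ≡⟨ mul′-embed-comm a b ⟩
    mul′ b (embed a)  ≡⟨ cong (mul′ b) (*-identityʳ a) ⟩
    mul′ b a          ∎

  *-identityˡ : ∀ a → 1R *R a ≡ a
  *-identityˡ a = trans (*-comm 1R a) (*-identityʳ a)

  mul′-assoc : ∀ {k} (a : Vec Z4 k) b c → mul′ (mul′ a b) c ≡ mul′ a (mul′ b c)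
  mul′-assoc [] b c = mul′-zsˡ {n} c
  mul′-assoc (x ∷ a) b c = begin
    mul′ (x · b ⊞ mulX (mul′ a b)) c           ≡⟨ mul′-⊞ˡ (x · b) (mulX (mul′ a b)) c ⟩
    mul′ (x · b) c ⊞ mul′ (mulX (mul′ a b)) c  ≡⟨ cong₂ _⊞_ (mul′-·ˡ x b c) mulX-step ⟩
    x · mul′ b c ⊞ mulX (mul′ a (mul′ b c))    ∎
    where
    mulX-step : mul′ (mulX (mul′ a b)) c ≡ mulX (mul′ a (mul′ b c))
    mulX-step = begin
      mul′ (mulX (mul′ a b)) c  ≡⟨ *-comm (mulX (mul′ a b)) c ⟩
      mul′ c (mulX (mul′ a b))  ≡⟨ mul′-mulX c (mul′ a b) ⟩
      mulX (mul′ c (mul′ a b))  ≡⟨ cong mulX (*-comm c (mul′ a b)) ⟩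
      mulX (mul′ (mul′ a b) c)  ≡⟨ cong mulX (mul′-assoc a b c) ⟩
      mulX (mul′ a (mul′ b c))  ∎

  commutativeRing : CommutativeRing _ _
  commutativeRing = record
    { Carrier = R
    ; _≈_ = _≡_
    ; _+_ = _+R_
    ; _*_ = _*R_
    ; -_ = V.map neg₄
    ; 0# = 0R
    ; 1# = 1R
    ; isCommutativeRing = record
      { isRing = record
        { +-isAbelianGroup = record
          { isGroup = record
            { isMonoid = record
              { isSemigroup = record
                { isMagma = record { isEquivalence = isEquivalence ; ∙-cong = cong₂ _+R_ }
                ; assoc = ⊞-assoc }
              ; identity = ⊞-identityˡ , ⊞-identityʳ }
            ; inverse = ⊞-inverseˡ , ⊞-inverseʳ
            ; ⁻¹-cong = cong (V.map neg₄) }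
          ; comm = ⊞-comm }
        ; *-cong = cong₂ _*R_
        ; *-assoc = mul′-assoc
        ; *-identity = *-identityˡ , *-identityʳ
        ; distrib = mul′-⊞ʳ , λ a b c → mul′-⊞ˡ b c a }
      ; *-comm = *-comm } }

  open CommutativeRing commutativeRing public using (*-assoc; distribˡ; distribʳ)
  open import Algebra.Properties.Group (CommutativeRing.+-group commutativeRing) public using () renaming (∙-cancelˡ to +-cancelˡ)
  open import Algebra.Solver.Ring.NaturalCoefficients.Default (CommutativeRing.commutativeSemiring commutativeRing) public
    using (solve; _:=_; _:+_; _:*_)

  *-left-comm : ∀ x y z → x *R (y *R z) ≡ y *R (x *R z)
  *-left-comm = solve 3 (λ x y z → (x :* (y :* z)) := (y :* (x :* z))) refl

  open import Algebra.Properties.CommutativeSemiring.Exp (CommutativeRing.commutativeSemiring commutativeRing)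
    using (^-homo-*; ^-assocʳ; ^-distrib-*) renaming (_^_ to _^R_)

  pow≡^ : ∀ x k → pow x k ≡ x ^R k
  pow≡^ x zero = refl
  pow≡^ x (suc k) = cong (x *R_) (pow≡^ x k)

  pow-+ : ∀ x a b → pow x (a + b) ≡ pow x a *R pow x b
  pow-+ x a b = begin
    pow x (a + b)          ≡⟨ pow≡^ x (a + b) ⟩
    x ^R (a + b)           ≡⟨ ^-homo-* x a b ⟩
    x ^R a *R x ^R b       ≡⟨ sym (cong₂ _*R_ (pow≡^ x a) (pow≡^ x b)) ⟩
    pow x a *R pow x b     ∎

  pow-distrib-* : ∀ x y k → pow (x *R y) k ≡ pow x k *R pow y k
  pow-distrib-* x y k = begin
    pow (x *R y) k         ≡⟨ pow≡^ (x *R y) k ⟩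
    (x *R y) ^R k          ≡⟨ ^-distrib-* x y k ⟩
    x ^R k *R y ^R k       ≡⟨ sym (cong₂ _*R_ (pow≡^ x k) (pow≡^ y k)) ⟩
    pow x k *R pow y k     ∎

  pow-pow : ∀ x a b → pow (pow x a) b ≡ pow x (a * b)
  pow-pow x a b = begin
    pow (pow x a) b        ≡⟨ pow≡^ (pow x a) b ⟩
    pow x a ^R b           ≡⟨ cong (_^R b) (pow≡^ x a) ⟩
    (x ^R a) ^R b          ≡⟨ ^-assocʳ x a b ⟩
    x ^R (a * b)           ≡⟨ sym (pow≡^ x (a * b)) ⟩
    pow x (a * b)          ∎

module Reduction (n : ℕ) (hs : Vec Z4 n) where

  open ℤ₄
  open Vectors
  open Bits
  open GR n hs
  open GaloisRing n hs

  -- the projection R_n → R_n/2R_n ≅ 𝔽₂ⁿ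
  red : ∀ {k} → Vec Z4 k → Vec Bool k
  red = V.map red₂

  red-⊞ : ∀ {k} (u v : Vec Z4 k) → red (u ⊞ v) ≡ red u ⊻ red v
  red-⊞ [] [] = refl
  red-⊞ (x ∷ u) (y ∷ v) = cong₂ _∷_ (red₂-+₄ x y) (red-⊞ u v)

  red-· : ∀ {k} c (u : Vec Z4 k) → red (c · u) ≡ V.map (red₂ c ∧_) (red u)
  red-· c [] = refl
  red-· c (x ∷ u) = cong₂ _∷_ (red₂-*₄ c x) (red-· c u)

  red-double : ∀ {k} (u : Vec Z4 k) → red (u ⊞ u) ≡ zeros
  red-double [] = refl
  red-double (x ∷ u) = cong₂ _∷_ (red₂-double x) (red-double u)

  red-zs : ∀ {k} → red (zs {k}) ≡ zeros
  red-zs {zero} = refl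
  red-zs {suc k} = cong (false ∷_) (red-zs {k})

  red-≡⇒+double : ∀ {k} (u v : Vec Z4 k) → red u ≡ red v → ∃ λ c → v ≡ u ⊞ (c ⊞ c)
  red-≡⇒+double [] [] _ = [] , refl
  red-≡⇒+double (x ∷ u) (y ∷ v) eq with red₂-≡⇒+double x y (cong V.head eq) | red-≡⇒+double u v (cong V.tail eq)
  ... | z , p | c , q = (z ∷ c) , cong₂ _∷_ p q

  red-+double : ∀ (u c : R) → red (u +R two· c) ≡ red u
  red-+double u c = begin
    red (u ⊞ (c ⊞ c))             ≡⟨ red-⊞ u (c ⊞ c) ⟩
    red u ⊻ red (c ⊞ c)           ≡⟨ cong (red u ⊻_) (red-double c) ⟩
    red u ⊻ zeros                 ≡⟨ ⊻-identityʳ (red u) ⟩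
    red u                         ∎

  red-*-congʳ : ∀ {u u′} v → red u ≡ red u′ → red (u *R v) ≡ red (u′ *R v)
  red-*-congʳ {u} {u′} v eq with red-≡⇒+double u u′ eq
  ... | c , refl = sym (begin
    red ((u ⊞ (c ⊞ c)) *R v)              ≡⟨ cong red (distribʳ v u (c ⊞ c)) ⟩
    red (u *R v ⊞ (c ⊞ c) *R v)           ≡⟨ cong (λ t → red (u *R v ⊞ t)) (distribʳ v c c) ⟩
    red (u *R v ⊞ (c *R v ⊞ c *R v))      ≡⟨ red-+double (u *R v) (c *R v) ⟩
    red (u *R v)                          ∎)

  red-*-congˡ : ∀ u {v v′} → red v ≡ red v′ → red (u *R v) ≡ red (u *R v′)
  red-*-congˡ u {v} {v′} eq = begin
    red (u *R v)   ≡⟨ cong red (*-comm u v) ⟩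
    red (v *R u)   ≡⟨ red-*-congʳ u eq ⟩
    red (v′ *R u)  ≡⟨ cong red (*-comm v′ u) ⟩
    red (u *R v′)  ∎

  red-*-cong : ∀ {u u′ v v′} → red u ≡ red u′ → red v ≡ red v′ → red (u *R v) ≡ red (u′ *R v′)
  red-*-cong {u′ = u′} {v} p q = trans (red-*-congʳ v p) (red-*-congˡ u′ q)

  red-+-cong : ∀ {u u′ v v′} → red u ≡ red u′ → red v ≡ red v′ → red (u +R v) ≡ red (u′ +R v′)
  red-+-cong {u} {u′} {v} {v′} p q = begin
    red (u ⊞ v)        ≡⟨ red-⊞ u v ⟩
    red u ⊻ red v      ≡⟨ cong₂ _⊻_ p q ⟩
    red u′ ⊻ red v′    ≡⟨ sym (red-⊞ u′ v′) ⟩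
    red (u′ ⊞ v′)      ∎

  red-mulX : ∀ u → red (mulX u) ≡ shiftIn false (red u) ⊻ V.map (carry false (red u) ∧_) (red hs)
  red-mulX u = begin
    red (mulX u)
      ≡⟨ cong red (mulX≡shiftIn+carry·hs u) ⟩
    red (shiftIn 0F u ⊞ neg₄ (carry 0F u) · hs)
      ≡⟨ red-⊞ (shiftIn 0F u) _ ⟩
    red (shiftIn 0F u) ⊻ red (neg₄ (carry 0F u) · hs)
      ≡⟨ cong₂ _⊻_ (sym (shiftIn-map red₂ 0F u)) (red-· (neg₄ (carry 0F u)) hs) ⟩
    shiftIn false (red u) ⊻ V.map (red₂ (neg₄ (carry 0F u)) ∧_) (red hs)
      ≡⟨ cong (λ t → shiftIn false (red u) ⊻ V.map (t ∧_) (red hs))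
              (trans (red₂-neg₄ (carry 0F u)) (sym (carry-map red₂ 0F u))) ⟩
    shiftIn false (red u) ⊻ V.map (carry false (red u) ∧_) (red hs) ∎

  red-mulX-cong : ∀ {u u′} → red u ≡ red u′ → red (mulX u) ≡ red (mulX u′)
  red-mulX-cong {u} {u′} p = begin
    red (mulX u)
      ≡⟨ red-mulX u ⟩
    shiftIn false (red u) ⊻ V.map (carry false (red u) ∧_) (red hs)
      ≡⟨ cong (λ t → shiftIn false t ⊻ V.map (carry false t ∧_) (red hs)) p ⟩
    shiftIn false (red u′) ⊻ V.map (carry false (red u′) ∧_) (red hs)
      ≡⟨ sym (red-mulX u′) ⟩
    red (mulX u′) ∎

  double*double≡0 : ∀ u v → two· u *R two· v ≡ 0R
  double*double≡0 u v = begin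
    (u ⊞ u) *R (v ⊞ v)                     ≡⟨ distribʳ (v ⊞ v) u u ⟩
    u *R (v ⊞ v) ⊞ u *R (v ⊞ v)            ≡⟨ cong (λ t → t ⊞ t) (distribˡ u v v) ⟩
    (u *R v ⊞ u *R v) ⊞ (u *R v ⊞ u *R v)  ≡⟨ double-double (u *R v) ⟩
    0R                                     ∎

  -- (a + 2c)² = a² + 2c(2a + 2c) = a², since 4 = 0
  red-≡⇒square≡ : ∀ {a b} → red a ≡ red b → a *R a ≡ b *R b
  red-≡⇒square≡ {a} {b} eq with red-≡⇒+double a b eq
  ... | c , refl = sym (begin
    (a ⊞ (c ⊞ c)) *R (a ⊞ (c ⊞ c))
      ≡⟨ solve 2 (λ a d → ((a :+ d) :* (a :+ d)) := ((a :* a) :+ (d :* ((a :+ a) :+ d)))) refl a (c ⊞ c) ⟩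
    a *R a ⊞ (c ⊞ c) *R ((a ⊞ a) ⊞ (c ⊞ c))
      ≡⟨ cong (λ t → a *R a ⊞ (c ⊞ c) *R t) (⊞-interchange a a c c) ⟩
    a *R a ⊞ (c ⊞ c) *R ((a ⊞ c) ⊞ (a ⊞ c))
      ≡⟨ cong (a *R a ⊞_) (double*double≡0 c (a ⊞ c)) ⟩
    a *R a ⊞ 0R
      ≡⟨ ⊞-identityʳ _ ⟩
    a *R a ∎)

  red-≡⇒double≡ : ∀ {u u′} → red u ≡ red u′ → two· u ≡ two· u′
  red-≡⇒double≡ {u} {u′} e with red-≡⇒+double u u′ e
  ... | c , refl = sym (begin
    (u ⊞ (c ⊞ c)) ⊞ (u ⊞ (c ⊞ c))  ≡⟨ ⊞-interchange u (c ⊞ c) u (c ⊞ c) ⟩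
    (u ⊞ u) ⊞ ((c ⊞ c) ⊞ (c ⊞ c))  ≡⟨ cong ((u ⊞ u) ⊞_) (double-double c) ⟩
    (u ⊞ u) ⊞ 0R                   ≡⟨ ⊞-identityʳ _ ⟩
    u ⊞ u                          ∎)

  double-injective-mod2 : ∀ {k} (u v : Vec Z4 k) → u ⊞ u ≡ v ⊞ v → red u ≡ red v
  double-injective-mod2 [] [] _ = refl
  double-injective-mod2 (x ∷ u) (y ∷ v) e =
    cong₂ _∷_ (double₄-injective-mod2 x y (cong V.head e)) (double-injective-mod2 u v (cong V.tail e))

module Evaluation (m : ℕ) (hs : Vec Z4 (suc m)) where

  open Vectors
  open Bits
  open GR (suc m) hs
  open GaloisRing (suc m) hs
  open Reduction (suc m) hs

  bit : Bool → R
  bit true = 1R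
  bit false = 0R

  eval : List Bool → R
  eval L.[] = 0R
  eval (c L.∷ l) = bit c +R mulX (eval l)

  evalᵛ : ∀ {k} → Vec Bool k → R
  evalᵛ v = eval (V.toList v)

  red-bit : ∀ c → red (bit c) ≡ c ∷ zeros
  red-bit true = cong (true ∷_) (red-zs {m})
  red-bit false = cong (false ∷_) (red-zs {m})

  red-eval : ∀ l → length l ≤ suc m → red (eval l) ≡ pad false l
  red-eval L.[] _ = trans red-zs (sym (pad-[] false))
  red-eval (c L.∷ l) (s≤s l≤m) = begin
    red (bit c ⊞ mulX (eval l))
      ≡⟨ red-⊞ (bit c) (mulX (eval l)) ⟩
    red (bit c) ⊻ red (mulX (eval l))
      ≡⟨ cong₂ _⊻_ (red-bit c) (red-mulX (eval l)) ⟩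
    (c ∷ zeros) ⊻ (shiftIn false (red (eval l)) ⊻ V.map (carry false (red (eval l)) ∧_) (red hs))
      ≡⟨ cong (λ t → (c ∷ zeros) ⊻ (shiftIn false t ⊻ V.map (carry false t ∧_) (red hs)))
              (red-eval l (≤-trans l≤m (n≤1+n m))) ⟩
    (c ∷ zeros) ⊻ (shiftIn false (pad false l) ⊻ V.map (carry false (pad {k = suc m} false l) ∧_) (red hs))
      ≡⟨ cong (λ t → (c ∷ zeros) ⊻ (shiftIn false (pad false l) ⊻ V.map (t ∧_) (red hs)))
              (carry-pad false false l (s≤s l≤m)) ⟩
    (c ∷ zeros) ⊻ (shiftIn false (pad false l) ⊻ V.map (false ∧_) (red hs))
      ≡⟨ cong (λ t → (c ∷ zeros) ⊻ (shiftIn false (pad false l) ⊻ t)) (VP.map-const (red hs) false) ⟩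
    (c ∷ zeros) ⊻ (shiftIn false (pad false l) ⊻ zeros)
      ≡⟨ cong ((c ∷ zeros) ⊻_) (trans (⊻-identityʳ _) (shiftIn-pad false false l (s≤s l≤m))) ⟩
    (c ∷ zeros) ⊻ (false ∷ pad false l)
      ≡⟨ cong₂ _∷_ (xor-identityʳ c) (⊻-identityˡ (pad false l)) ⟩
    c ∷ pad false l ∎

  red-evalᵛ : (v : Vec Bool (suc m)) → red (evalᵛ v) ≡ v
  red-evalᵛ v = trans (red-eval _ (≤-reflexive (VP.length-toList v))) (pad-toList false v)

  red-bit-xor : ∀ a b → red (bit (a xor b)) ≡ red (bit a +R bit b)
  red-bit-xor a b = begin
    red (bit (a xor b))          ≡⟨ red-bit (a xor b) ⟩
    (a xor b) ∷ zeros            ≡⟨ cong ((a xor b) ∷_) (sym (⊻-identityʳ zeros)) ⟩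
    (a ∷ zeros) ⊻ (b ∷ zeros)    ≡⟨ sym (cong₂ _⊻_ (red-bit a) (red-bit b)) ⟩
    red (bit a) ⊻ red (bit b)    ≡⟨ sym (red-⊞ (bit a) (bit b)) ⟩
    red (bit a +R bit b)         ∎

  red-eval-addP : ∀ p q → red (eval (addP p q)) ≡ red (eval p +R eval q)
  red-eval-addP L.[] q = cong red (sym (⊞-identityˡ (eval q)))
  red-eval-addP (a L.∷ p) L.[] = cong red (sym (⊞-identityʳ (eval (a L.∷ p))))
  red-eval-addP (a L.∷ p) (b L.∷ q) = begin
    red (bit (a xor b) ⊞ mulX (eval (addP p q)))
      ≡⟨ red-+-cong (red-bit-xor a b) (trans (red-mulX-cong (red-eval-addP p q)) (cong red (mulX-⊞ (eval p) (eval q)))) ⟩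
    red ((bit a ⊞ bit b) ⊞ (mulX (eval p) ⊞ mulX (eval q)))
      ≡⟨ cong red (⊞-interchange (bit a) (bit b) _ _) ⟩
    red ((bit a ⊞ mulX (eval p)) ⊞ (bit b ⊞ mulX (eval q))) ∎

  eval-false∷ : ∀ l → eval (false L.∷ l) ≡ mulX (eval l)
  eval-false∷ l = ⊞-identityˡ (mulX (eval l))

  eval-map-false∧ : ∀ q → eval (L.map (false ∧_) q) ≡ 0R
  eval-map-false∧ L.[] = refl
  eval-map-false∧ (x L.∷ q) = begin
    eval (false L.∷ L.map (false ∧_) q)  ≡⟨ eval-false∷ (L.map (false ∧_) q) ⟩
    mulX (eval (L.map (false ∧_) q))  ≡⟨ cong mulX (eval-map-false∧ q) ⟩
    mulX 0R                           ≡⟨ mulX-zs ⟩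
    0R                                ∎

  eval-map-∧ : ∀ a q → eval (L.map (a ∧_) q) ≡ bit a *R eval q
  eval-map-∧ true q = trans (cong eval (map-id q)) (sym (*-identityˡ (eval q)))
  eval-map-∧ false q = trans (eval-map-false∧ q) (sym (mul′-zsˡ {suc m} (eval q)))

  mulX≡*x : ∀ u → mulX u ≡ u *R mulX 1R
  mulX≡*x u = sym (trans (mul′-mulX u 1R) (cong mulX (*-identityʳ u)))

  mulX-*ˡ : ∀ u v → mulX (u *R v) ≡ mulX u *R v
  mulX-*ˡ u v = begin
    mulX (u *R v)          ≡⟨ mulX≡*x (u *R v) ⟩
    (u *R v) *R x          ≡⟨ *-assoc u v x ⟩
    u *R (v *R x)          ≡⟨ cong (u *R_) (*-comm v x) ⟩
    u *R (x *R v)          ≡⟨ sym (*-assoc u x v) ⟩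
    (u *R x) *R v          ≡⟨ cong (_*R v) (sym (mulX≡*x u)) ⟩
    mulX u *R v            ∎
    where x = mulX 1R

  red-eval-mulP : ∀ p q → red (eval (mulP p q)) ≡ red (eval p *R eval q)
  red-eval-mulP L.[] q = cong red (sym (mul′-zsˡ {suc m} (eval q)))
  red-eval-mulP (a L.∷ p) q = begin
    red (eval (addP (L.map (a ∧_) q) (false L.∷ mulP p q)))
      ≡⟨ red-eval-addP (L.map (a ∧_) q) _ ⟩
    red (eval (L.map (a ∧_) q) ⊞ eval (false L.∷ mulP p q))
      ≡⟨ red-+-cong (cong red (eval-map-∧ a q)) (begin
           red (eval (false L.∷ mulP p q))  ≡⟨ cong red (eval-false∷ (mulP p q)) ⟩
           red (mulX (eval (mulP p q)))     ≡⟨ red-mulX-cong (red-eval-mulP p q) ⟩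
           red (mulX (eval p *R eval q))    ≡⟨ cong red (mulX-*ˡ (eval p) (eval q)) ⟩
           red (mulX (eval p) *R eval q)    ∎) ⟩
    red (bit a *R eval q ⊞ mulX (eval p) *R eval q)
      ≡⟨ cong red (sym (distribʳ (eval q) (bit a) (mulX (eval p)))) ⟩
    red ((bit a ⊞ mulX (eval p)) *R eval q) ∎

  mulXⁿ : ℕ → R → R
  mulXⁿ zero u = u
  mulXⁿ (suc k) u = mulX (mulXⁿ k u)

  mulXⁿ-zs : ∀ k → mulXⁿ k 0R ≡ 0R
  mulXⁿ-zs zero = refl
  mulXⁿ-zs (suc k) = trans (cong mulX (mulXⁿ-zs k)) mulX-zs

  eval-++ : ∀ l l′ → eval (l ++ l′) ≡ eval l +R mulXⁿ (length l) (eval l′)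
  eval-++ L.[] l′ = sym (⊞-identityˡ _)
  eval-++ (c L.∷ l) l′ = begin
    bit c ⊞ mulX (eval (l ++ l′))                                ≡⟨ cong (λ t → bit c ⊞ mulX t) (eval-++ l l′) ⟩
    bit c ⊞ mulX (eval l ⊞ mulXⁿ (length l) (eval l′))           ≡⟨ cong (bit c ⊞_) (mulX-⊞ (eval l) _) ⟩
    bit c ⊞ (mulX (eval l) ⊞ mulX (mulXⁿ (length l) (eval l′)))  ≡⟨ sym (⊞-assoc (bit c) _ _) ⟩
    (bit c ⊞ mulX (eval l)) ⊞ mulX (mulXⁿ (length l) (eval l′))  ∎

  eval-∷ʳ-false : ∀ l → eval (l ++ L.[ false ]) ≡ eval l
  eval-∷ʳ-false l = begin
    eval (l ++ L.[ false ])                 ≡⟨ eval-++ l _ ⟩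
    eval l ⊞ mulXⁿ (length l) (0R ⊞ mulX 0R)
      ≡⟨ cong (λ t → eval l ⊞ mulXⁿ (length l) t) (trans (⊞-identityˡ (mulX 0R)) mulX-zs) ⟩
    eval l ⊞ mulXⁿ (length l) 0R            ≡⟨ cong (eval l ⊞_) (mulXⁿ-zs (length l)) ⟩
    eval l ⊞ 0R                             ≡⟨ ⊞-identityʳ (eval l) ⟩
    eval l                                  ∎

  eval-∷ʳ-true : ∀ l → eval (l ++ L.[ true ]) ≡ eval l +R mulXⁿ (length l) 1R
  eval-∷ʳ-true l = trans (eval-++ l _) (cong (λ t → eval l ⊞ mulXⁿ (length l) t) (trans (cong (1R ⊞_) mulX-zs) (⊞-identityʳ 1R)))

  evalᵛ-∷ʳ : ∀ {k} (a : Vec Bool k) t → evalᵛ (a V.∷ʳ t) ≡ eval (V.toList a ++ L.[ t ])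
  evalᵛ-∷ʳ a t = cong eval (VP.toList-∷ʳ t a)

  toList-⊻ : ∀ {k} (a b : Vec Bool k) → V.toList (a ⊻ b) ≡ addP (V.toList a) (V.toList b)
  toList-⊻ [] [] = refl
  toList-⊻ (x ∷ a) (y ∷ b) = cong ((x xor y) L.∷_) (toList-⊻ a b)

  red-evalᵛ-⊻ : ∀ {k} (a b : Vec Bool k) → red (evalᵛ (a ⊻ b)) ≡ red (evalᵛ a +R evalᵛ b)
  red-evalᵛ-⊻ a b = trans (cong (λ l → red (eval l)) (toList-⊻ a b)) (red-eval-addP (V.toList a) (V.toList b))

  evalᵛ-map-∧ : ∀ {k} t (a : Vec Bool k) → evalᵛ (V.map (t ∧_) a) ≡ bit t *R evalᵛ a
  evalᵛ-map-∧ t a = trans (cong eval (VP.toList-map (t ∧_) a)) (eval-map-∧ t (V.toList a))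

module Cardinalities (m : ℕ) (hs : Vec Z4 (suc m)) where

  open Bits
  open Counting
  open GR (suc m) hs
  open GaloisRing (suc m) hs
  open Reduction (suc m) hs
  open Evaluation m hs using (evalᵛ; red-evalᵛ)
  open ℤ₄ using (highBit₄; highBit₄-double)

  ∈-allVec : ∀ {k} (v : Vec Z4 k) → v ∈ allVec k
  ∈-allVec [] = here refl
  ∈-allVec (a ∷ v) = ∈-cartesianProductWith⁺ _∷_ (∈-allFin a) (∈-allVec v)

  ∈-allR : ∀ v → v ∈ allR
  ∈-allR = ∈-allVec

  allVec-unique : ∀ k → Unique (allVec k)
  allVec-unique zero = All.[] ∷ []
  allVec-unique (suc k) = Unique.cartesianProductWith⁺ _∷_ ∷-injective (Unique.allFin⁺ 4) (allVec-unique k)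
    where
    ∷-injective : ∀ {a b} {u v : Vec Z4 k} → a ∷ u ≡ b ∷ v → a ≡ b × u ≡ v
    ∷-injective refl = refl , refl

  length-allVec : ∀ k → length (allVec k) ≡ 2 ^ k * 2 ^ k
  length-allVec zero = refl
  length-allVec (suc k) = begin
    length (allVec (suc k))         ≡⟨ length-cartesianProductWith _∷_ allZ4 (allVec k) ⟩
    4 * length (allVec k)           ≡⟨ cong (4 *_) (length-allVec k) ⟩
    4 * (2 ^ k * 2 ^ k)             ≡⟨ 4a²≡[2a]² (2 ^ k) ⟩
    2 ^ suc k * 2 ^ suc k           ∎
    where
    open import Data.Nat.Tactic.RingSolver using (solve-∀)
    4a²≡[2a]² : ∀ a → 4 * (a * a) ≡ (2 * a) * (2 * a)
    4a²≡[2a]² = solve-∀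

  allR-unique : Unique allR
  allR-unique = allVec-unique (suc m)

  highBits-double : ∀ {k} (r : Vec Z4 k) → V.map highBit₄ (r ⊞ r) ≡ red r
  highBits-double [] = refl
  highBits-double (x ∷ r) = cong₂ _∷_ (highBit₄-double x) (highBits-double r)

  -- r ↦ 2r identifies 𝔽₂ⁿ with 2R_n; the high bits invert it
  length-2R : length (filter In2R? allR) ≡ 2 ^ suc m
  length-2R = trans (≤-antisym
    (injection⇒length≤ (Unique.filter⁺ In2R? allR-unique) (V.map highBit₄) (λ _ → ∈-allBits _) highBits-injective)
    (injection⇒length≤ (allBits-unique (suc m)) (λ v → two· (evalᵛ v)) (λ {v} _ → double∈2R (evalᵛ v)) double-injective))
    (length-allBits (suc m))
    where
    ∈2R⁻ : ∀ {x} → x ∈ filter In2R? allR → ∃ λ r → x ≡ two· r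
    ∈2R⁻ x∈ with find (proj₂ (∈-filter⁻ In2R? {xs = allR} x∈))
    ... | r , _ , x≡ = r , x≡
    double∈2R : ∀ r → two· r ∈ filter In2R? allR
    double∈2R r = ∈-filter⁺ In2R? (∈-allR (two· r)) (lose (∈-allR r) refl)
    highBits-injective : ∀ {x y} → x ∈ filter In2R? allR → y ∈ filter In2R? allR →
                         V.map highBit₄ x ≡ V.map highBit₄ y → x ≡ y
    highBits-injective x∈ y∈ e with ∈2R⁻ x∈ | ∈2R⁻ y∈
    ... | r , refl | s , refl = red-≡⇒double≡ (trans (sym (highBits-double r)) (trans e (highBits-double s)))
    double-injective : ∀ {v w} → v ∈ allBits (suc m) → w ∈ allBits (suc m) → two· (evalᵛ v) ≡ two· (evalᵛ w) → v ≡ w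
    double-injective {v} {w} _ _ e = trans (sym (red-evalᵛ v)) (trans (double-injective-mod2 (evalᵛ v) (evalᵛ w) e) (red-evalᵛ w))

module ResidueDomain (m : ℕ) (hs : Vec Z4 (suc m)) where

  open Vectors
  open Bits
  open GR (suc m) hs
  open GaloisRing (suc m) hs
  open Reduction (suc m) hs
  open Evaluation m hs
  open BinaryPolynomials

  monic : ∀ {d} → Vec Bool d → Vec Bool (suc d)
  monic g = g V.∷ʳ true

  module Annihilator (b : R) where

    Ann : R → Set
    Ann u = red (u *R b) ≡ zeros

    Ann? : ∀ u → Dec (Ann u)
    Ann? u = VP.≡-dec Bool._≟_ (red (u *R b)) zeros

    Ann-resp : ∀ {u u′} → red u ≡ red u′ → Ann u → Ann u′
    Ann-resp e au = trans (sym (red-*-congʳ b e)) au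

    Ann-ideal : ∀ {u} v → Ann u → Ann (u *R v)
    Ann-ideal {u} v au = begin
      red ((u *R v) *R b)  ≡⟨ cong red (solve 3 (λ u v b → ((u :* v) :* b) := ((u :* b) :* v)) refl u v b) ⟩
      red ((u *R b) *R v)  ≡⟨ red-*-congʳ {u *R b} {0R} v (trans au (sym (red-zs {suc m}))) ⟩
      red (0R *R v)        ≡⟨ cong red (mul′-zsˡ {suc m} v) ⟩
      red 0R               ≡⟨ red-zs {suc m} ⟩
      zeros                ∎

    HasMonic : ℕ → Set
    HasMonic d = ∃ λ (g : Vec Bool d) → Ann (evalᵛ (monic g))

    HasMonic? : ∀ d → Dec (HasMonic d)
    HasMonic? d = any?-Bits d (λ g → Ann? (evalᵛ (monic g)))

    NoMonicBelow : ℕ → Set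
    NoMonicBelow D = ∀ d → d < D → ¬ HasMonic d

    -- strip the leading coefficient: it is 0, since otherwise r would be a monic element of lower degree
    noMonicBelow⇒red≡0 : ∀ D → NoMonicBelow D → (r : Vec Bool D) → Ann (evalᵛ r) → red (evalᵛ r) ≡ zeros
    noMonicBelow⇒red≡0 zero _ [] _ = red-zs {suc m}
    noMonicBelow⇒red≡0 (suc D) none r ar with V.last r in last≡
    ... | true = ⊥-elim (none D ≤-refl (V.init r , subst (λ t → Ann (evalᵛ t)) r≡ ar))
      where r≡ = trans (init∷ʳlast r) (cong (V.init r V.∷ʳ_) last≡)
    ... | false = trans (cong red r≡init)
                    (noMonicBelow⇒red≡0 D (λ d d<D → none d (≤-trans d<D (n≤1+n D))) (V.init r) (subst Ann r≡init ar))
      where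
      r≡init : evalᵛ r ≡ evalᵛ (V.init r)
      r≡init = begin
        evalᵛ r                                   ≡⟨ cong evalᵛ (trans (init∷ʳlast r) (cong (V.init r V.∷ʳ_) last≡)) ⟩
        evalᵛ (V.init r V.∷ʳ false)               ≡⟨ evalᵛ-∷ʳ (V.init r) false ⟩
        eval (V.toList (V.init r) ++ L.[ false ]) ≡⟨ eval-∷ʳ-false (V.toList (V.init r)) ⟩
        evalᵛ (V.init r)                          ∎

  -- long division by the monic polynomial w = g + x^d, valid in R/2R
  module Division {d : ℕ} (g : Vec Bool d) where

    w : R
    w = evalᵛ (monic g)

    -- cancel the top coefficient t of cr by subtracting t·w
    dropTop : (cr : Vec Bool (suc d)) →
              red (evalᵛ cr) ≡ red (evalᵛ (V.init (cr ⊻ V.map (V.last cr ∧_) (monic g))) +R bit (V.last cr) *R w)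
    dropTop cr = sym (begin
      red (evalᵛ r ⊞ bit t *R w)                          ≡⟨ red-⊞ (evalᵛ r) (bit t *R w) ⟩
      red (evalᵛ r) ⊻ red (bit t *R w)                    ≡⟨ cong (λ z → red z ⊻ red (bit t *R w)) (sym u≡r) ⟩
      red (evalᵛ u) ⊻ red (bit t *R w)                    ≡⟨ cong (_⊻ red (bit t *R w)) red-u ⟩
      (red (evalᵛ cr) ⊻ red (bit t *R w)) ⊻ red (bit t *R w)  ≡⟨ ⊻-cancelʳ _ _ ⟩
      red (evalᵛ cr)                                      ∎)
      where
      t = V.last cr
      u = cr ⊻ V.map (t ∧_) (monic g)
      r = V.init u
      last-u : V.last u ≡ false
      last-u = begin
        V.last u                              ≡⟨ last-zipWith _xor_ cr (V.map (t ∧_) (monic g)) ⟩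
        t xor V.last (V.map (t ∧_) (monic g)) ≡⟨ cong (t xor_) (last-map (t ∧_) (monic g)) ⟩
        t xor (t ∧ V.last (monic g))          ≡⟨ cong (λ z → t xor (t ∧ z)) (VP.last-∷ʳ true g) ⟩
        t xor (t ∧ true)                      ≡⟨ cong (t xor_) (∧-identityʳ t) ⟩
        t xor t                               ≡⟨ xor-same t ⟩
        false                                 ∎
      u≡r : evalᵛ u ≡ evalᵛ r
      u≡r = begin
        evalᵛ u                           ≡⟨ cong evalᵛ (trans (init∷ʳlast u) (cong (r V.∷ʳ_) last-u)) ⟩
        evalᵛ (r V.∷ʳ false)              ≡⟨ evalᵛ-∷ʳ r false ⟩
        eval (V.toList r ++ L.[ false ])  ≡⟨ eval-∷ʳ-false (V.toList r) ⟩
        evalᵛ r                           ∎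
      red-u : red (evalᵛ u) ≡ red (evalᵛ cr) ⊻ red (bit t *R w)
      red-u = begin
        red (evalᵛ u)                     ≡⟨ red-evalᵛ-⊻ cr (V.map (t ∧_) (monic g)) ⟩
        red (evalᵛ cr ⊞ evalᵛ (V.map (t ∧_) (monic g)))  ≡⟨ cong (λ z → red (evalᵛ cr ⊞ z)) (evalᵛ-map-∧ t (monic g)) ⟩
        red (evalᵛ cr ⊞ bit t *R w)       ≡⟨ red-⊞ (evalᵛ cr) (bit t *R w) ⟩
        red (evalᵛ cr) ⊻ red (bit t *R w) ∎

    LeadingAgrees : ∀ j → Vec Bool j → Vec Bool (j + d) → Vec Bool d → Set
    LeadingAgrees zero p v r = r ≡ v
    LeadingAgrees (suc j) p v r = V.last p ≡ V.last v

    divide : ∀ j (v : Vec Bool (j + d)) → ∃ λ (p : Vec Bool j) → ∃ λ (r : Vec Bool d) →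
             red (evalᵛ v) ≡ red (w *R evalᵛ p +R evalᵛ r) × LeadingAgrees j p v r
    divide zero v = [] , v , cong red (sym (trans (cong (_⊞ evalᵛ v) (mul′-zsʳ w)) (⊞-identityˡ (evalᵛ v)))) , refl
    divide (suc j) (c ∷ v′) with divide j v′
    ... | p′ , r′ , v′≡ , agree = t ∷ p′ , r , v≡ , agree′ j p′ v′ agree
      where
      t = V.last (c ∷ r′)
      r = V.init ((c ∷ r′) ⊻ V.map (t ∧_) (monic g))
      agree′ : ∀ j (p′ : Vec Bool j) (v′ : Vec Bool (j + d)) → LeadingAgrees j p′ v′ r′ →
               LeadingAgrees (suc j) (t ∷ p′) (c ∷ v′) r
      agree′ zero [] v′ r′≡v′ = cong (λ z → V.last (c ∷ z)) r′≡v′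
      agree′ (suc j) (x ∷ p′) (y ∷ v′) agree = agree
      v≡ : red (evalᵛ (c ∷ v′)) ≡ red (w *R evalᵛ (t ∷ p′) ⊞ evalᵛ r)
      v≡ = begin
        red (bit c ⊞ mulX (evalᵛ v′))
          ≡⟨ red-+-cong {bit c} refl (red-mulX-cong v′≡) ⟩
        red (bit c ⊞ mulX (w *R evalᵛ p′ ⊞ evalᵛ r′))
          ≡⟨ cong (λ z → red (bit c ⊞ z)) (mulX-⊞ (w *R evalᵛ p′) (evalᵛ r′)) ⟩
        red (bit c ⊞ (mulX (w *R evalᵛ p′) ⊞ mulX (evalᵛ r′)))
          ≡⟨ cong red (solve 3 (λ a x y → (a :+ (x :+ y)) := ((a :+ y) :+ x)) refl
                              (bit c) (mulX (w *R evalᵛ p′)) (mulX (evalᵛ r′))) ⟩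
        red (evalᵛ (c ∷ r′) ⊞ mulX (w *R evalᵛ p′))
          ≡⟨ red-+-cong (dropTop (c ∷ r′)) refl ⟩
        red ((evalᵛ r ⊞ bit t *R w) ⊞ mulX (w *R evalᵛ p′))
          ≡⟨ cong (λ z → red ((evalᵛ r ⊞ bit t *R w) ⊞ z)) (sym (mul′-mulX w (evalᵛ p′))) ⟩
        red ((evalᵛ r ⊞ bit t *R w) ⊞ w *R mulX (evalᵛ p′))
          ≡⟨ cong red (solve 4 (λ r t w xp → ((r :+ (t :* w)) :+ (w :* xp)) := ((w :* (t :+ xp)) :+ r)) refl
                              (evalᵛ r) (bit t) w (mulX (evalᵛ p′))) ⟩
        red (w *R (bit t ⊞ mulX (evalᵛ p′)) ⊞ evalᵛ r) ∎

  eval-replicate-false : ∀ k → eval (L.replicate k false) ≡ 0R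
  eval-replicate-false zero = refl
  eval-replicate-false (suc k) = begin
    eval (false L.∷ L.replicate k false)  ≡⟨ eval-false∷ (L.replicate k false) ⟩
    mulX (eval (L.replicate k false))     ≡⟨ cong mulX (eval-replicate-false k) ⟩
    mulX 0R                               ≡⟨ mulX-zs ⟩
    0R                                    ∎

  -- xⁿ = -(h₀ + h₁x + ⋯), which reduces to h̄₀ + h̄₁x + ⋯
  red-xⁿ : red (mulXⁿ (suc m) 1R) ≡ red hs
  red-xⁿ = begin
    red (mulX (mulXⁿ m 1R))
      ≡⟨ red-mulX (mulXⁿ m 1R) ⟩
    shiftIn false (red (mulXⁿ m 1R)) ⊻ V.map (carry false (red (mulXⁿ m 1R)) ∧_) (red hs)
      ≡⟨ cong (λ z → shiftIn false z ⊻ V.map (carry false z ∧_) (red hs)) red-xᵐ ⟩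
    shiftIn false (zeros {m} V.∷ʳ true) ⊻ V.map (carry false (zeros {m} V.∷ʳ true) ∧_) (red hs)
      ≡⟨ cong₂ (λ a c → a ⊻ V.map (c ∧_) (red hs)) (shiftIn-∷ʳ {k = m} false true) (carry-∷ʳ {k = m} false true) ⟩
    zeros ⊻ V.map (true ∧_) (red hs)
      ≡⟨ trans (⊻-identityˡ _) (VP.map-id (red hs)) ⟩
    red hs ∎
    where
    xᵐ-list = L.replicate m false ++ L.[ true ]
    length-xᵐ-list : length xᵐ-list ≡ suc m
    length-xᵐ-list = trans (length-++ (L.replicate m false)) (trans (cong (_+ 1) (length-replicate m)) (+-comm m 1))
    eval-xᵐ-list : eval xᵐ-list ≡ mulXⁿ m 1R
    eval-xᵐ-list = begin
      eval xᵐ-list                                       ≡⟨ eval-∷ʳ-true (L.replicate m false) ⟩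
      eval (L.replicate m false) ⊞ mulXⁿ (length (L.replicate m false)) 1R
        ≡⟨ cong₂ (λ a l → a ⊞ mulXⁿ l 1R) (eval-replicate-false m) (length-replicate m) ⟩
      0R ⊞ mulXⁿ m 1R                                    ≡⟨ ⊞-identityˡ _ ⟩
      mulXⁿ m 1R                                         ∎
    red-xᵐ : red (mulXⁿ m 1R) ≡ zeros {m} V.∷ʳ true
    red-xᵐ = begin
      red (mulXⁿ m 1R)    ≡⟨ cong red (sym eval-xᵐ-list) ⟩
      red (eval xᵐ-list)  ≡⟨ red-eval xᵐ-list (≤-reflexive length-xᵐ-list) ⟩
      pad false xᵐ-list   ≡⟨ pad-replicate-∷ʳ m false true ⟩
      zeros V.∷ʳ true     ∎

  -- in R/2R, c = xⁿ = h̄₀ + ⋯ + h̄ₙ₋₁xⁿ⁻¹, and below degree n evaluation is injective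
  vanishing-monic≡h̄ : ∀ c → length c ≡ suc m → red (eval (c ++ L.[ true ])) ≡ zeros → c ≡ V.toList (red hs)
  vanishing-monic≡h̄ c len vanishes = pad-injective false c (V.toList (red hs)) len (VP.length-toList (red hs)) (begin
    pad false c               ≡⟨ sym (red-eval c (≤-reflexive len)) ⟩
    red (eval c)              ≡⟨ ⊻≡zeros⇒≡ _ _ red-c+xⁿ≡0 ⟩
    red (mulXⁿ (suc m) 1R)    ≡⟨ red-xⁿ ⟩
    red hs                    ≡⟨ sym (pad-toList false (red hs)) ⟩
    pad false (V.toList (red hs)) ∎)
    where
    red-c+xⁿ≡0 : red (eval c) ⊻ red (mulXⁿ (suc m) 1R) ≡ zeros
    red-c+xⁿ≡0 = begin
      red (eval c) ⊻ red (mulXⁿ (suc m) 1R)         ≡⟨ sym (red-⊞ (eval c) _) ⟩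
      red (eval c ⊞ mulXⁿ (suc m) 1R)               ≡⟨ cong (λ l → red (eval c ⊞ mulXⁿ l 1R)) (sym len) ⟩
      red (eval c ⊞ mulXⁿ (length c) 1R)            ≡⟨ cong red (sym (eval-∷ʳ-true c)) ⟩
      red (eval (c ++ L.[ true ]))                  ≡⟨ vanishes ⟩
      zeros                                         ∎

  h̄-vanishes : red (eval (V.toList (red hs) ++ L.[ true ])) ≡ zeros
  h̄-vanishes = begin
    red (eval (V.toList (red hs) ++ L.[ true ]))
      ≡⟨ cong red (eval-∷ʳ-true (V.toList (red hs))) ⟩
    red (eval (V.toList (red hs)) ⊞ mulXⁿ (length (V.toList (red hs))) 1R)
      ≡⟨ cong (λ k → red (eval (V.toList (red hs)) ⊞ mulXⁿ k 1R)) (VP.length-toList (red hs)) ⟩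
    red (eval (V.toList (red hs)) ⊞ mulXⁿ (suc m) 1R)
      ≡⟨ red-⊞ _ _ ⟩
    red (evalᵛ (red hs)) ⊻ red (mulXⁿ (suc m) 1R)
      ≡⟨ cong₂ _⊻_ (red-evalᵛ (red hs)) red-xⁿ ⟩
    red hs ⊻ red hs
      ≡⟨ ⊻-self (red hs) ⟩
    zeros ∎

  module _ {b : R} where

    open Annihilator b

    -- a monic annihilator of least degree d with 0 < d < n is a proper factor of h̄
    leastMonicAnnihilator⇒reducible : ∀ {d₀ e₀} (g : Vec Bool (suc d₀)) → suc d₀ + e₀ ≡ m →
      Ann (evalᵛ (monic g)) → NoMonicBelow (suc d₀) → ¬ BasicIrreducible hs
    leastMonicAnnihilator⇒reducible {d₀} {e₀} g de ann-w least irr =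
      irr (d₀ , e₀ , trans (+-comm (suc d₀) (suc e₀)) (sym suc-m≡) , g , k , trans mulP≡c (cong (_++ L.[ true ]) c≡h̄))
      where
      open Division g
      suc-m≡ : suc m ≡ suc e₀ + suc d₀
      suc-m≡ = trans (cong suc (sym de)) (cong suc (+-comm (suc d₀) e₀))
      h̄ : Vec Bool (suc (suc e₀) + suc d₀)
      h̄ = subst (λ k → Vec Bool (suc k)) suc-m≡ (monic (red hs))
      last-h̄ : V.last h̄ ≡ true
      last-h̄ = trans (last-subst suc-m≡ (monic (red hs))) (VP.last-∷ʳ true (red hs))
        where
        last-subst : ∀ {a c} (eq : a ≡ c) (x : Vec Bool (suc a)) → V.last (subst (λ k → Vec Bool (suc k)) eq x) ≡ V.last x
        last-subst refl x = refl
      h̄-vanishes′ : red (evalᵛ h̄) ≡ zeros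
      h̄-vanishes′ = trans (cong (λ l → red (eval l)) (toList-subst suc-m≡ _))
                      (trans (cong (λ l → red (eval l)) (VP.toList-∷ʳ true (red hs))) h̄-vanishes)
        where
        toList-subst : ∀ {a c} (eq : a ≡ c) (x : Vec Bool (suc a)) → V.toList (subst (λ k → Vec Bool (suc k)) eq x) ≡ V.toList x
        toList-subst refl x = refl
      division = divide (suc (suc e₀)) h̄
      p : Vec Bool (suc (suc e₀))
      p = proj₁ division
      r : Vec Bool (suc d₀)
      r = proj₁ (proj₂ division)
      h̄≡wp+r : red (evalᵛ h̄) ≡ red (w *R evalᵛ p +R evalᵛ r)
      h̄≡wp+r = proj₁ (proj₂ (proj₂ division))
      leading : V.last p ≡ V.last h̄
      leading = proj₂ (proj₂ (proj₂ division))
      red-wp≡red-r : red (w *R evalᵛ p) ≡ red (evalᵛ r)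
      red-wp≡red-r = ⊻≡zeros⇒≡ _ _ (trans (sym (red-⊞ (w *R evalᵛ p) (evalᵛ r))) (trans (sym h̄≡wp+r) h̄-vanishes′))
      -- the remainder lies in the annihilator and has lower degree, so it vanishes
      wp-vanishes : red (w *R evalᵛ p) ≡ zeros
      wp-vanishes = trans red-wp≡red-r (noMonicBelow⇒red≡0 (suc d₀) least r (Ann-resp red-wp≡red-r (Ann-ideal {w} (evalᵛ p) ann-w)))
      k : Vec Bool (suc e₀)
      k = V.init p
      p≡monic-k : p ≡ monic k
      p≡monic-k = trans (init∷ʳlast p) (cong (k V.∷ʳ_) (trans leading last-h̄))
      product = mulP-monic (V.toList g) (V.toList k)
      c : List Bool
      c = proj₁ product
      mulP≡c : mulP (monic₂ g) (monic₂ k) ≡ c ++ L.[ true ]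
      mulP≡c = proj₁ (proj₂ product)
      length-c : length c ≡ suc m
      length-c = trans (proj₂ (proj₂ product)) (begin
        length (V.toList g) + length (V.toList k)  ≡⟨ cong₂ _+_ (VP.length-toList g) (VP.length-toList k) ⟩
        suc d₀ + suc e₀                            ≡⟨ +-comm (suc d₀) (suc e₀) ⟩
        suc e₀ + suc d₀                            ≡⟨ sym suc-m≡ ⟩
        suc m                                      ∎)
      c≡h̄ : c ≡ V.toList (red hs)
      c≡h̄ = vanishing-monic≡h̄ c length-c (begin
        red (eval (c ++ L.[ true ]))        ≡⟨ cong (λ l → red (eval l)) (sym mulP≡c) ⟩
        red (eval (mulP (monic₂ g) (monic₂ k)))  ≡⟨ red-eval-mulP (monic₂ g) (monic₂ k) ⟩
        red (eval (monic₂ g) *R eval (monic₂ k))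
          ≡⟨ cong₂ (λ x y → red (x *R y)) (sym (evalᵛ-∷ʳ g true)) (trans (sym (evalᵛ-∷ʳ k true)) (cong evalᵛ (sym p≡monic-k))) ⟩
        red (w *R evalᵛ p)                  ≡⟨ wp-vanishes ⟩
        zeros                               ∎)

    noMonicAnnihilator : BasicIrreducible hs → red b ≢ zeros → NoMonicBelow (suc m)
    noMonicAnnihilator irr b≢0 with leastBelow HasMonic HasMonic? (suc m)
    ... | inj₂ none = none
    ... | inj₁ (zero , _ , ([] , ann-1) , _) = ⊥-elim (b≢0 (trans (cong red (sym 1*b≡b)) ann-1))
      where
      1*b≡b : evalᵛ (monic []) *R b ≡ b
      1*b≡b = trans (cong (_*R b) (trans (cong (1R ⊞_) mulX-zs) (⊞-identityʳ 1R))) (*-identityˡ b)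
    ... | inj₁ (suc d₀ , s≤s d₀<m , (g , ann-w) , least) with m≤n⇒∃[o]m+o≡n d₀<m
    ...   | e₀ , de = ⊥-elim (leastMonicAnnihilator⇒reducible g de ann-w least irr)

  domain : BasicIrreducible hs → ∀ a b → red (a *R b) ≡ zeros → red a ≢ zeros → red b ≡ zeros
  domain irr a b ab≡0 a≢0 with VP.≡-dec Bool._≟_ (red b) zeros
  ... | yes b≡0 = b≡0
  ... | no b≢0 = ⊥-elim (a≢0 (trans (sym red-a) (noMonicBelow⇒red≡0 (suc m) (noMonicAnnihilator {b} irr b≢0) (red a) ann-a)))
    where
    open Annihilator b
    red-a : red (evalᵛ (red a)) ≡ red a
    red-a = red-evalᵛ (red a)
    ann-a : Ann (evalᵛ (red a))
    ann-a = Ann-resp (sym red-a) ab≡0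

module Fermat (m : ℕ) (hs : Vec Z4 (suc m)) (irr : BasicIrreducible hs) where

  open Bits
  open Counting
  open GR (suc m) hs
  open GaloisRing (suc m) hs
  open Reduction (suc m) hs
  open Evaluation m hs
  open ResidueDomain m hs

  lift : Vec Bool (suc m) → R
  lift = evalᵛ

  prod : List R → R
  prod = foldr _*R_ 1R

  red-1R≢0 : red 1R ≢ zeros
  red-1R≢0 e with cong V.head e
  ... | ()

  prod-nonzero : ∀ (xs : List (Vec Bool (suc m))) → (∀ {v} → v ∈ xs → v ≢ zeros) → red (prod (L.map lift xs)) ≢ zeros
  prod-nonzero L.[] _ = red-1R≢0
  prod-nonzero (v L.∷ xs) nz e = prod-nonzero xs (λ v∈ → nz (there v∈))
    (domain irr (lift v) _ e (λ e′ → nz (here refl) (trans (sym (red-evalᵛ v)) e′)))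

  prod-scale : ∀ r (xs : List (Vec Bool (suc m))) →
               prod (L.map (λ v → r *R lift v) xs) ≡ pow r (length xs) *R prod (L.map lift xs)
  prod-scale r L.[] = sym (*-identityˡ 1R)
  prod-scale r (v L.∷ xs) = begin
    (r *R lift v) *R prod (L.map (λ v → r *R lift v) xs)
      ≡⟨ cong ((r *R lift v) *R_) (prod-scale r xs) ⟩
    (r *R lift v) *R (pow r (length xs) *R prod (L.map lift xs))
      ≡⟨ solve 4 (λ r l q p → ((r :* l) :* (q :* p)) := ((r :* q) :* (l :* p))) refl r (lift v) (pow r (length xs)) _ ⟩
    (r *R pow r (length xs)) *R (lift v *R prod (L.map lift xs)) ∎

  red-prod-cong : ∀ (xs : List (Vec Bool (suc m))) (g h : Vec Bool (suc m) → R) → (∀ v → red (g v) ≡ red (h v)) →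
                  red (prod (L.map g xs)) ≡ red (prod (L.map h xs))
  red-prod-cong L.[] g h e = refl
  red-prod-cong (v L.∷ xs) g h e = red-*-cong (e v) (red-prod-cong xs g h e)

  -- multiplication by r ≢ 0 permutes the nonzero residues, so P = r^(2ⁿ-1) P for their product P ≢ 0
  fermat : ∀ r → red (pow r (2 ^ suc m)) ≡ red r
  fermat r = trans (cong (λ k → red (pow r k)) (sym (suc-length-nonzeroBits (suc m)))) red-r·rᴺ≡red-r
    where
    NZ = nonzeroBits (suc m)
    N = length NZ
    red-r·rᴺ≡red-r : red (r *R pow r N) ≡ red r
    red-r·rᴺ≡red-r with VP.≡-dec Bool._≟_ (red r) zeros
    ... | yes r≡0 = begin
      red (r *R pow r N)   ≡⟨ red-*-congʳ {r} {0R} (pow r N) (trans r≡0 (sym (red-zs {suc m}))) ⟩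
      red (0R *R pow r N)  ≡⟨ cong red (mul′-zsˡ {suc m} (pow r N)) ⟩
      red 0R               ≡⟨ trans (red-zs {suc m}) (sym r≡0) ⟩
      red r                ∎
    ... | no r≢0 = trans (red-*-congˡ r (sym red-1≡red-rᴺ)) (cong red (*-identityʳ r))
      where
      times-r : Vec Bool (suc m) → Vec Bool (suc m)
      times-r v = red (r *R lift v)
      times-r-injective : ∀ {v v′} → times-r v ≡ times-r v′ → v ≡ v′
      times-r-injective {v} {v′} e = ⊻≡zeros⇒≡ v v′ (begin
        v ⊻ v′                          ≡⟨ sym (cong₂ _⊻_ (red-evalᵛ v) (red-evalᵛ v′)) ⟩
        red (lift v) ⊻ red (lift v′)    ≡⟨ sym (red-⊞ (lift v) (lift v′)) ⟩
        red (lift v ⊞ lift v′)          ≡⟨ domain irr r _ r·[v+v′]≡0 r≢0 ⟩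
        zeros                           ∎)
        where
        r·[v+v′]≡0 : red (r *R (lift v ⊞ lift v′)) ≡ zeros
        r·[v+v′]≡0 = begin
          red (r *R (lift v ⊞ lift v′))             ≡⟨ cong red (distribˡ r (lift v) (lift v′)) ⟩
          red (r *R lift v ⊞ r *R lift v′)          ≡⟨ red-⊞ (r *R lift v) (r *R lift v′) ⟩
          times-r v ⊻ times-r v′                    ≡⟨ cong (times-r v ⊻_) (sym e) ⟩
          times-r v ⊻ times-r v                     ≡⟨ ⊻-self (times-r v) ⟩
          zeros                                     ∎
      times-r-nonzero : ∀ v → v ≢ zeros → times-r v ≢ zeros
      times-r-nonzero v v≢0 e = v≢0 (trans (sym (red-evalᵛ v)) (domain irr r (lift v) e r≢0))
      ⊆NZ : ∀ {x} → x ∈ L.map times-r NZ → x ∈ NZ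
      ⊆NZ x∈ with ∈-map⁻ times-r x∈
      ... | v , v∈ , refl = ∈-nonzeroBits (times-r v) (times-r-nonzero v (nonzeroBits-nonzero v∈))
      permutes : L.map times-r NZ ↭ NZ
      permutes = unique-⊆⇒↭ (Unique.map⁺ times-r-injective (nonzeroBits-unique (suc m))) ⊆NZ
                   (≤-reflexive (sym (length-map times-r NZ)))
      P = prod (L.map lift NZ)
      red-rᴺP≡red-P : red (pow r N *R P) ≡ red P
      red-rᴺP≡red-P = begin
        red (pow r N *R P)                              ≡⟨ cong red (sym (prod-scale r NZ)) ⟩
        red (prod (L.map (λ v → r *R lift v) NZ))
          ≡⟨ sym (red-prod-cong NZ (λ v → lift (times-r v)) _ (λ v → red-evalᵛ (times-r v))) ⟩
        red (prod (L.map (λ v → lift (times-r v)) NZ))  ≡⟨ cong (λ l → red (prod l)) (map-∘ NZ) ⟩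
        red (prod (L.map lift (L.map times-r NZ)))
          ≡⟨ cong red (foldr-↭ _*R_ 1R *-left-comm (Perm.map⁺ lift permutes)) ⟩
        red P                                           ∎
      P·[rᴺ+1]≡0 : red (P *R (pow r N +R 1R)) ≡ zeros
      P·[rᴺ+1]≡0 = begin
        red (P *R (pow r N +R 1R))          ≡⟨ cong red (distribˡ P (pow r N) 1R) ⟩
        red (P *R pow r N +R P *R 1R)       ≡⟨ red-⊞ _ _ ⟩
        red (P *R pow r N) ⊻ red (P *R 1R)
          ≡⟨ cong₂ _⊻_ (trans (cong red (*-comm P (pow r N))) red-rᴺP≡red-P) (cong red (*-identityʳ P)) ⟩
        red P ⊻ red P                       ≡⟨ ⊻-self (red P) ⟩
        zeros                               ∎
      red-1≡red-rᴺ : red 1R ≡ red (pow r N)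
      red-1≡red-rᴺ = sym (⊻≡zeros⇒≡ _ _ (trans (sym (red-⊞ (pow r N) 1R))
                       (domain irr P _ P·[rᴺ+1]≡0 (prod-nonzero NZ nonzeroBits-nonzero))))

module Teichmüller (m : ℕ) (hs : Vec Z4 (suc m)) (irr : BasicIrreducible hs) where

  open Bits
  open GR (suc m) hs
  open GaloisRing (suc m) hs
  open Reduction (suc m) hs
  open Cardinalities m hs using (∈-allR)
  open ResidueDomain m hs using (domain)
  open Fermat m hs irr using (fermat)

  q h : ℕ
  q = 2 ^ suc m
  h = 2 ^ m

  q≡h+h : q ≡ h + h
  q≡h+h = cong (h +_) (+-identityʳ h)

  pow-q≡square^h : ∀ x → pow x q ≡ pow (x *R x) h
  pow-q≡square^h x = begin
    pow x q                ≡⟨ cong (pow x) q≡h+h ⟩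
    pow x (h + h)          ≡⟨ pow-+ x h h ⟩
    pow x h *R pow x h     ≡⟨ sym (pow-distrib-* x x h) ⟩
    pow (x *R x) h         ∎

  -- the Teichmüller representative of x: the unique element of Γ congruent to x
  teich : R → R
  teich x = pow x q

  red-teich : ∀ x → red (teich x) ≡ red x
  red-teich = fermat

  red-≡⇒teich≡ : ∀ {a b} → red a ≡ red b → teich a ≡ teich b
  red-≡⇒teich≡ {a} {b} e = begin
    pow a q          ≡⟨ pow-q≡square^h a ⟩
    pow (a *R a) h   ≡⟨ cong (λ t → pow t h) (red-≡⇒square≡ e) ⟩
    pow (b *R b) h   ≡⟨ sym (pow-q≡square^h b) ⟩
    pow b q          ∎

  teich-InΓ : ∀ x → InΓ (teich x)
  teich-InΓ x = red-≡⇒teich≡ (red-teich x)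

  InΓ-red-injective : ∀ {a b} → InΓ a → InΓ b → red a ≡ red b → a ≡ b
  InΓ-red-injective {a} {b} a∈Γ b∈Γ e = trans (sym a∈Γ) (trans (red-≡⇒teich≡ e) b∈Γ)

  InΓ-* : ∀ {a b} → InΓ a → InΓ b → InΓ (a *R b)
  InΓ-* {a} {b} a∈Γ b∈Γ = trans (pow-distrib-* a b q) (cong₂ _*R_ a∈Γ b∈Γ)

  InΓ-square : ∀ x → InΓ (x *R x)
  InΓ-square x = trans (pow-distrib-* x x q) (red-≡⇒square≡ (red-teich x))

  InΓ-0 : InΓ 0R
  InΓ-0 = subst InΓ (mul′-zsˡ {suc m} 0R) (InΓ-square 0R)

  -- square roots: u^h is the square root of u ∈ Γ
  pow-h-square : ∀ {u} → InΓ u → pow u h *R pow u h ≡ u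
  pow-h-square {u} u∈Γ = trans (sym (pow-+ u h h)) (trans (cong (pow u) (sym q≡h+h)) u∈Γ)

  InΓ-pow-h : ∀ {u} → InΓ u → InΓ (pow u h)
  InΓ-pow-h {u} u∈Γ = begin
    pow (pow u h) q  ≡⟨ pow-pow u h q ⟩
    pow u (h * q)    ≡⟨ cong (pow u) (ℕ.*-comm h q) ⟩
    pow u (q * h)    ≡⟨ sym (pow-pow u q h) ⟩
    pow (pow u q) h  ≡⟨ cong (λ t → pow t h) u∈Γ ⟩
    pow u h          ∎

  square-injective : ∀ {y y′} → InΓ y → InΓ y′ → y *R y ≡ y′ *R y′ → y ≡ y′
  square-injective {y} {y′} y∈Γ y′∈Γ e = begin
    y                  ≡⟨ sym y∈Γ ⟩
    pow y q            ≡⟨ pow-q≡square^h y ⟩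
    pow (y *R y) h     ≡⟨ cong (λ t → pow t h) e ⟩
    pow (y′ *R y′) h   ≡⟨ sym (pow-q≡square^h y′) ⟩
    pow y′ q           ≡⟨ y′∈Γ ⟩
    y′                 ∎

  ∈-Γlist⇒InΓ : ∀ {x} → x ∈ Γlist → InΓ x
  ∈-Γlist⇒InΓ x∈ = proj₂ (∈-filter⁻ InΓ? {xs = allR} x∈)

  InΓ⇒∈-Γlist : ∀ {x} → InΓ x → x ∈ Γlist
  InΓ⇒∈-Γlist {x} x∈Γ = ∈-filter⁺ InΓ? (∈-allR x) x∈Γ

  firstWith-satisfies : ∀ (l : List R) p → (∃ λ y → y ∈ l × p y ≡ true) → firstWith l p ∈ l × p (firstWith l p) ≡ true
  firstWith-satisfies (y L.∷ ys) p ex with p y in py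
  ... | true = here refl , py
  ... | false with ex
  ...   | z , here refl , pz with () ← trans (sym py) pz
  ...   | z , there z∈ , pz with firstWith-satisfies ys p (z , z∈ , pz)
  ...     | ∈ys , pfirst = there ∈ys , pfirst

  eqb-sound : ∀ {a b} → eqb a b ≡ true → a ≡ b
  eqb-sound {a} {b} e with a ≟R b
  ... | yes a≡b = a≡b

  eqb-refl : ∀ a → eqb a a ≡ true
  eqb-refl a with a ≟R a
  ... | yes _ = refl
  ... | no a≢a = ⊥-elim (a≢a refl)

  sqrtΓ-spec : ∀ {u} → InΓ u → InΓ (sqrtΓ u) × sqrtΓ u *R sqrtΓ u ≡ u
  sqrtΓ-spec {u} u∈Γ with firstWith-satisfies Γlist (λ y → eqb (y *R y) u)
    (pow u h , InΓ⇒∈-Γlist (InΓ-pow-h u∈Γ) , subst (λ t → eqb t u ≡ true) (sym (pow-h-square u∈Γ)) (eqb-refl u))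
  ... | root∈ , root² = ∈-Γlist⇒InΓ root∈ , eqb-sound root²

  sqrtΓ-square : ∀ {y} → InΓ y → sqrtΓ (y *R y) ≡ y
  sqrtΓ-square {y} y∈Γ with sqrtΓ-spec (InΓ-square y)
  ... | s∈Γ , s² = square-injective s∈Γ y∈Γ s²

  sqrtΓ-* : ∀ {x y} → InΓ x → InΓ y → sqrtΓ (x *R y) ≡ sqrtΓ x *R sqrtΓ y
  sqrtΓ-* {x} {y} x∈Γ y∈Γ with sqrtΓ-spec x∈Γ | sqrtΓ-spec y∈Γ
  ... | s∈Γ , s² | t∈Γ , t² = begin
    sqrtΓ (x *R y)                          ≡⟨ cong sqrtΓ (sym (cong₂ _*R_ s² t²)) ⟩
    sqrtΓ ((s *R s) *R (t *R t))
      ≡⟨ cong sqrtΓ (solve 2 (λ s t → ((s :* s) :* (t :* t)) := ((s :* t) :* (s :* t))) refl s t) ⟩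
    sqrtΓ ((s *R t) *R (s *R t))            ≡⟨ sqrtΓ-square (InΓ-* s∈Γ t∈Γ) ⟩
    s *R t                                  ∎
    where
    s = sqrtΓ x
    t = sqrtΓ y

  Γ-decomposition : ∀ g → ∃ λ a → ∃ λ b → InΓ a × InΓ b × g ≡ a +R two· b
  Γ-decomposition g with red-≡⇒+double (teich g) g (red-teich g)
  ... | c , g≡ = teich g , teich c , teich-InΓ g , teich-InΓ c , trans g≡ (cong (teich g +R_) (red-≡⇒double≡ (sym (red-teich c))))

  Γ-decomposition-unique : ∀ {a b a′ b′} → InΓ a → InΓ b → InΓ a′ → InΓ b′ →
                           a +R two· b ≡ a′ +R two· b′ → a ≡ a′ × b ≡ b′
  Γ-decomposition-unique {a} {b} {a′} {b′} a∈Γ b∈Γ a′∈Γ b′∈Γ e = a≡a′ , b≡b′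
    where
    a≡a′ : a ≡ a′
    a≡a′ = InΓ-red-injective a∈Γ a′∈Γ (trans (sym (red-+double a b)) (trans (cong red e) (red-+double a′ b′)))
    b≡b′ : b ≡ b′
    b≡b′ = InΓ-red-injective b∈Γ b′∈Γ
             (double-injective-mod2 b b′ (+-cancelˡ a (two· b) (two· b′) (trans e (cong (_+R two· b′) (sym a≡a′)))))

  red-⊕ : ∀ x y → red (x ⊕ y) ≡ red x ⊻ red y
  red-⊕ x y = trans (red-+double (x +R y) (sqrtΓ (x *R y))) (red-⊞ x y)

  -- (√x + √y)² = x + y + 2√x√y, and √x√y = √(xy)
  ⊕≡square : ∀ {x y} → InΓ x → InΓ y → x ⊕ y ≡ (sqrtΓ x +R sqrtΓ y) *R (sqrtΓ x +R sqrtΓ y)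
  ⊕≡square {x} {y} x∈Γ y∈Γ with sqrtΓ-spec x∈Γ | sqrtΓ-spec y∈Γ
  ... | _ , s² | _ , t² = begin
    (x ⊞ y) ⊞ two· (sqrtΓ (x *R y))       ≡⟨ cong (λ z → (x ⊞ y) ⊞ two· z) (sqrtΓ-* x∈Γ y∈Γ) ⟩
    (x ⊞ y) ⊞ two· (s *R t)               ≡⟨ cong₂ (λ a b → (a ⊞ b) ⊞ two· (s *R t)) (sym s²) (sym t²) ⟩
    (s *R s ⊞ t *R t) ⊞ two· (s *R t)
      ≡⟨ solve 2 (λ s t → (((s :* s) :+ (t :* t)) :+ ((s :* t) :+ (s :* t))) := ((s :+ t) :* (s :+ t))) refl s t ⟩
    (s +R t) *R (s +R t)                  ∎
    where
    s = sqrtΓ x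
    t = sqrtΓ y

  InΓ-⊕ : ∀ {x y} → InΓ x → InΓ y → InΓ (x ⊕ y)
  InΓ-⊕ {x} {y} x∈Γ y∈Γ = subst InΓ (sym (⊕≡square x∈Γ y∈Γ)) (InΓ-square (sqrtΓ x +R sqrtΓ y))

  ⊕-cancelʳ : ∀ {x y a} → InΓ x → InΓ y → InΓ a → x ⊕ y ≡ a → x ≡ y ⊕ a
  ⊕-cancelʳ {x} {y} {a} x∈Γ y∈Γ a∈Γ e = InΓ-red-injective x∈Γ (InΓ-⊕ y∈Γ a∈Γ) (begin
    red x                    ≡⟨ sym (⊻-cancelʳ (red x) (red y)) ⟩
    (red x ⊻ red y) ⊻ red y  ≡⟨ cong (_⊻ red y) (trans (sym (red-⊕ x y)) (cong red e)) ⟩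
    red a ⊻ red y            ≡⟨ ⊻-comm (red a) (red y) ⟩
    red y ⊻ red a            ≡⟨ sym (red-⊕ y a) ⟩
    red (y ⊕ a)              ∎)

  ⊕-cancelʳ⁻¹ : ∀ {x y a} → InΓ x → InΓ y → InΓ a → x ≡ y ⊕ a → x ⊕ y ≡ a
  ⊕-cancelʳ⁻¹ {x} {y} {a} x∈Γ y∈Γ a∈Γ refl = InΓ-red-injective (InΓ-⊕ x∈Γ y∈Γ) a∈Γ (begin
    red ((y ⊕ a) ⊕ y)        ≡⟨ red-⊕ (y ⊕ a) y ⟩
    red (y ⊕ a) ⊻ red y      ≡⟨ cong (_⊻ red y) (red-⊕ y a) ⟩
    (red y ⊻ red a) ⊻ red y  ≡⟨ cong (_⊻ red y) (⊻-comm (red y) (red a)) ⟩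
    (red a ⊻ red y) ⊻ red y  ≡⟨ ⊻-cancelʳ (red a) (red y) ⟩
    red a                    ∎)

  red-square-⊞ : ∀ u v → red ((u +R v) *R (u +R v)) ≡ red (u *R u) ⊻ red (v *R v)
  red-square-⊞ u v = begin
    red ((u ⊞ v) *R (u ⊞ v))
      ≡⟨ cong red (solve 2 (λ u v → ((u :+ v) :* (u :+ v)) := (((u :* u) :+ (v :* v)) :+ ((u :* v) :+ (u :* v)))) refl u v) ⟩
    red ((u *R u ⊞ v *R v) ⊞ two· (u *R v))  ≡⟨ red-+double _ (u *R v) ⟩
    red (u *R u ⊞ v *R v)                    ≡⟨ red-⊞ _ _ ⟩
    red (u *R u) ⊻ red (v *R v)              ∎

  -- Frobenius is injective on the domain R/2R
  red-square-injective : ∀ {u v} → red (u *R u) ≡ red (v *R v) → red u ≡ red v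
  red-square-injective {u} {v} e = ⊻≡zeros⇒≡ (red u) (red v) (trans (sym (red-⊞ u v)) red-u+v≡0)
    where
    red-[u+v]²≡0 : red ((u +R v) *R (u +R v)) ≡ zeros
    red-[u+v]²≡0 = trans (red-square-⊞ u v) (trans (cong (_⊻ red (v *R v)) e) (⊻-self _))
    red-u+v≡0 : red (u +R v) ≡ zeros
    red-u+v≡0 with VP.≡-dec Bool._≟_ (red (u +R v)) zeros
    ... | yes p = p
    ... | no ¬p = ⊥-elim (¬p (domain irr (u +R v) (u +R v) red-[u+v]²≡0 ¬p))

module DifferenceSet (m : ℕ) (hs : Vec Z4 (suc m)) (irr : BasicIrreducible hs)
                     (f : Vec Z4 (suc m) → Vec Z4 (suc m)) (f∈Γ : ∀ x → GR.InΓ (suc m) hs x → GR.InΓ (suc m) hs (f x)) where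

  open Bits
  open Counting
  open GR (suc m) hs
  open GaloisRing (suc m) hs
  open Reduction (suc m) hs
  open Evaluation m hs using (evalᵛ; red-evalᵛ)
  open Teichmüller m hs irr
  open Cardinalities m hs using (∈-allR; allR-unique)

  φ : R → R
  φ x = x +R two· (sqrtΓ (f x))

  Δ : R → R → R
  Δ a y = f (y ⊕ a) ⊕ f y ⊕ (a *R y)

  κ : R → R → R
  κ x y = sqrtΓ (x *R y) +R y +R sqrtΓ (f x) +R sqrtΓ (f y)

  -- −v = v + 2v and −2v = 2v turn φ x − φ y into (x ⊕ y) + 2κ
  φ-difference : ∀ x y → φ x -R φ y ≡ (x ⊕ y) +R two· (teich (κ x y))
  φ-difference x y = begin
    φ x -R φ y                               ≡⟨ cong ((x ⊞ (s ⊞ s)) ⊞_) (neg≡triple (y ⊞ (t ⊞ t))) ⟩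
    lhs                                      ≡⟨ sym (⊞-identityʳ lhs) ⟩
    lhs ⊞ 0R                                 ≡⟨ cong (lhs ⊞_) (sym (double-double w)) ⟩
    lhs ⊞ ((w ⊞ w) ⊞ (w ⊞ w))
      ≡⟨ solve 5 (λ x y s t w → ((x :+ (s :+ s)) :+ (((y :+ (t :+ t)) :+ (y :+ (t :+ t))) :+ (y :+ (t :+ t)))) :+ ((w :+ w) :+ (w :+ w))
                             := ((((x :+ y) :+ (w :+ w)) :+ ((((w :+ y) :+ s) :+ t) :+ (((w :+ y) :+ s) :+ t))) :+ ((t :+ t) :+ (t :+ t)))) refl x y s t w ⟩
    rhs ⊞ ((t ⊞ t) ⊞ (t ⊞ t))                ≡⟨ cong (rhs ⊞_) (double-double t) ⟩
    rhs ⊞ 0R                                 ≡⟨ ⊞-identityʳ rhs ⟩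
    rhs                                      ≡⟨ cong ((x ⊕ y) ⊞_) (red-≡⇒double≡ (sym (red-teich (κ x y)))) ⟩
    (x ⊕ y) ⊞ two· (teich (κ x y))           ∎
    where
    s = sqrtΓ (f x)
    t = sqrtΓ (f y)
    w = sqrtΓ (x *R y)
    lhs = (x ⊞ (s ⊞ s)) ⊞ (((y ⊞ (t ⊞ t)) ⊞ (y ⊞ (t ⊞ t))) ⊞ (y ⊞ (t ⊞ t)))
    rhs = (x ⊕ y) ⊞ two· (κ x y)

  red-κ² : ∀ {x y} → InΓ x → InΓ y → red (κ x y *R κ x y) ≡ red (x *R y) ⊻ red (y *R y) ⊻ red (f x) ⊻ red (f y)
  red-κ² {x} {y} x∈Γ y∈Γ = begin
    red (κ x y *R κ x y)
      ≡⟨ red-square-⊞ (w ⊞ y ⊞ s) t ⟩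
    red ((w ⊞ y ⊞ s) *R (w ⊞ y ⊞ s)) ⊻ red (t *R t)
      ≡⟨ cong (_⊻ red (t *R t)) (red-square-⊞ (w ⊞ y) s) ⟩
    red ((w ⊞ y) *R (w ⊞ y)) ⊻ red (s *R s) ⊻ red (t *R t)
      ≡⟨ cong (λ z → z ⊻ red (s *R s) ⊻ red (t *R t)) (red-square-⊞ w y) ⟩
    red (w *R w) ⊻ red (y *R y) ⊻ red (s *R s) ⊻ red (t *R t)
      ≡⟨ cong₃ (λ a b c → red a ⊻ red (y *R y) ⊻ red b ⊻ red c)
               (proj₂ (sqrtΓ-spec (InΓ-* x∈Γ y∈Γ))) (proj₂ (sqrtΓ-spec (f∈Γ x x∈Γ))) (proj₂ (sqrtΓ-spec (f∈Γ y y∈Γ))) ⟩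
    red (x *R y) ⊻ red (y *R y) ⊻ red (f x) ⊻ red (f y) ∎
    where
    s = sqrtΓ (f x)
    t = sqrtΓ (f y)
    w = sqrtΓ (x *R y)
    cong₃ : ∀ {A B C D : Set} (g : A → B → C → D) {a a′ b b′ c c′} → a ≡ a′ → b ≡ b′ → c ≡ c′ → g a b c ≡ g a′ b′ c′
    cong₃ g refl refl refl = refl

  red-Δ : ∀ {x y a} → InΓ x → InΓ y → x ⊕ y ≡ a → red (Δ a y) ≡ red (κ x y *R κ x y)
  red-Δ {x} {y} {a} x∈Γ y∈Γ x⊕y≡a = begin
    red (f (y ⊕ a) ⊕ f y ⊕ (a *R y))
      ≡⟨ trans (red-⊕ _ _) (cong (_⊻ red (a *R y)) (red-⊕ _ _)) ⟩
    red (f (y ⊕ a)) ⊻ red (f y) ⊻ red (a *R y)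
      ≡⟨ cong (λ z → red (f z) ⊻ red (f y) ⊻ red (a *R y)) (sym x≡y⊕a) ⟩
    red (f x) ⊻ red (f y) ⊻ red (a *R y)
      ≡⟨ cong (red (f x) ⊻ red (f y) ⊻_) red-ay ⟩
    (red (f x) ⊻ red (f y)) ⊻ (red (x *R y) ⊻ red (y *R y))
      ≡⟨ ⊻-comm (red (f x) ⊻ red (f y)) _ ⟩
    (red (x *R y) ⊻ red (y *R y)) ⊻ (red (f x) ⊻ red (f y))
      ≡⟨ sym (⊻-assoc (red (x *R y) ⊻ red (y *R y)) (red (f x)) (red (f y))) ⟩
    red (x *R y) ⊻ red (y *R y) ⊻ red (f x) ⊻ red (f y)
      ≡⟨ sym (red-κ² x∈Γ y∈Γ) ⟩
    red (κ x y *R κ x y) ∎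
    where
    x≡y⊕a : x ≡ y ⊕ a
    x≡y⊕a = ⊕-cancelʳ x∈Γ y∈Γ (subst InΓ x⊕y≡a (InΓ-⊕ x∈Γ y∈Γ)) x⊕y≡a
    red-ay : red (a *R y) ≡ red (x *R y) ⊻ red (y *R y)
    red-ay = begin
      red (a *R y)                  ≡⟨ cong (λ z → red (z *R y)) (sym x⊕y≡a) ⟩
      red ((x ⊕ y) *R y)            ≡⟨ red-*-congʳ y (trans (red-⊕ x y) (sym (red-⊞ x y))) ⟩
      red ((x ⊞ y) *R y)            ≡⟨ cong red (distribʳ y x y) ⟩
      red (x *R y ⊞ y *R y)         ≡⟨ red-⊞ _ _ ⟩
      red (x *R y) ⊻ red (y *R y)   ∎

  InΓ-Δ : ∀ {a y} → InΓ a → InΓ y → InΓ (Δ a y)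
  InΓ-Δ a∈Γ y∈Γ = InΓ-⊕ (InΓ-⊕ (f∈Γ _ (InΓ-⊕ y∈Γ a∈Γ)) (f∈Γ _ y∈Γ)) (InΓ-* a∈Γ y∈Γ)

  φ-difference⇒ : ∀ {x y a b} → InΓ x → InΓ y → InΓ a → InΓ b →
                  φ x -R φ y ≡ a +R two· b → x ≡ y ⊕ a × Δ a y ≡ b *R b
  φ-difference⇒ {x} {y} {a} {b} x∈Γ y∈Γ a∈Γ b∈Γ e =
    conclude (Γ-decomposition-unique (InΓ-⊕ x∈Γ y∈Γ) (teich-InΓ (κ x y)) a∈Γ b∈Γ (trans (sym (φ-difference x y)) e))
    where
    conclude : x ⊕ y ≡ a × teich (κ x y) ≡ b → x ≡ y ⊕ a × Δ a y ≡ b *R b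
    conclude (x⊕y≡a , teich-κ≡b) =
      ⊕-cancelʳ x∈Γ y∈Γ a∈Γ x⊕y≡a , InΓ-red-injective (InΓ-Δ a∈Γ y∈Γ) (InΓ-square b) (begin
      red (Δ a y)              ≡⟨ red-Δ x∈Γ y∈Γ x⊕y≡a ⟩
      red (κ x y *R κ x y)     ≡⟨ cong red (red-≡⇒square≡ (trans (sym (red-teich (κ x y))) (cong red teich-κ≡b))) ⟩
      red (b *R b)             ∎)

  φ-difference⇐ : ∀ {x y a b} → InΓ x → InΓ y → InΓ a → InΓ b →
                  x ≡ y ⊕ a → Δ a y ≡ b *R b → φ x -R φ y ≡ a +R two· b
  φ-difference⇐ {x} {y} {a} {b} x∈Γ y∈Γ a∈Γ b∈Γ x≡y⊕a Δ≡b² = begin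
    φ x -R φ y                      ≡⟨ φ-difference x y ⟩
    (x ⊕ y) +R two· (teich (κ x y)) ≡⟨ cong₂ (λ u v → u +R two· v) x⊕y≡a teich-κ≡b ⟩
    a +R two· b                     ∎
    where
    x⊕y≡a : x ⊕ y ≡ a
    x⊕y≡a = ⊕-cancelʳ⁻¹ x∈Γ y∈Γ a∈Γ x≡y⊕a
    teich-κ≡b : teich (κ x y) ≡ b
    teich-κ≡b = InΓ-red-injective (teich-InΓ (κ x y)) b∈Γ (begin
      red (teich (κ x y))      ≡⟨ red-teich (κ x y) ⟩
      red (κ x y)              ≡⟨ red-square-injective (trans (sym (red-Δ x∈Γ y∈Γ x⊕y≡a)) (cong red Δ≡b²)) ⟩
      red b                    ∎)

  private
    InD? : ∀ g → Dec (InD f g)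
    InD? g = Any.any? (λ x → g ≟R (x +R two· (sqrtΓ (f x)))) Γlist

  D : List R
  D = Dlist f

  ∈-D⁻ : ∀ {d} → d ∈ D → ∃ λ x → InΓ x × d ≡ φ x
  ∈-D⁻ {d} d∈ with find (proj₂ (∈-filter⁻ InD? {xs = allR} d∈))
  ... | x , x∈ , d≡ = x , ∈-Γlist⇒InΓ x∈ , d≡

  ∈-D⁺ : ∀ {x} → InΓ x → φ x ∈ D
  ∈-D⁺ {x} x∈Γ = ∈-filter⁺ InD? (∈-allR (φ x)) (lose (InΓ⇒∈-Γlist x∈Γ) refl)

  red-φ : ∀ x → red (φ x) ≡ red x
  red-φ x = red-+double x (sqrtΓ (f x))

  φ-injective : ∀ {x y} → InΓ x → InΓ y → φ x ≡ φ y → x ≡ y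
  φ-injective x∈Γ y∈Γ e = InΓ-red-injective x∈Γ y∈Γ (trans (sym (red-φ _)) (trans (cong red e) (red-φ _)))

  Pairs : R → List (R × R)
  Pairs g = filter (λ p → (proj₁ p -R proj₂ p) ≟R g) (cartesianProduct D D)

  ∈-Pairs⁻ : ∀ {g p} → p ∈ Pairs g → ∃ λ x → ∃ λ y → InΓ x × InΓ y × p ≡ (φ x , φ y) × φ x -R φ y ≡ g
  ∈-Pairs⁻ {g} {d₁ , d₂} p∈ with ∈-filter⁻ (λ p → (proj₁ p -R proj₂ p) ≟R g) {xs = cartesianProduct D D} p∈
  ... | pair∈ , diff with ∈-cartesianProduct⁻ D D pair∈
  ...   | d₁∈ , d₂∈ with ∈-D⁻ d₁∈ | ∈-D⁻ d₂∈
  ...     | x , x∈Γ , refl | y , y∈Γ , refl = x , y , x∈Γ , y∈Γ , refl , diff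

  ∈-Pairs⁺ : ∀ {g x y} → InΓ x → InΓ y → φ x -R φ y ≡ g → (φ x , φ y) ∈ Pairs g
  ∈-Pairs⁺ {g} x∈Γ y∈Γ e =
    ∈-filter⁺ (λ p → (proj₁ p -R proj₂ p) ≟R g) (∈-cartesianProduct⁺ (∈-D⁺ x∈Γ) (∈-D⁺ y∈Γ)) e


  D-unique : Unique D
  D-unique = Unique.filter⁺ InD? allR-unique

  Pairs-unique : ∀ g → Unique (Pairs g)
  Pairs-unique g = Unique.filter⁺ _ (Unique.cartesianProduct⁺ D-unique D-unique)

  -- reduction mod 2 is a bijection D → 𝔽₂ⁿ
  length-D : length D ≡ 2 ^ suc m
  length-D = trans (≤-antisym
    (injection⇒length≤ D-unique red (λ _ → ∈-allBits _) red-injective)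
    (injection⇒length≤ (allBits-unique (suc m)) (λ v → φ (teich (evalᵛ v))) (λ _ → ∈-D⁺ (teich-InΓ _)) lift-injective))
    (length-allBits (suc m))
    where
    red-injective : ∀ {d d′} → d ∈ D → d′ ∈ D → red d ≡ red d′ → d ≡ d′
    red-injective d∈ d′∈ e with ∈-D⁻ d∈ | ∈-D⁻ d′∈
    ... | x , x∈Γ , refl | y , y∈Γ , refl = cong φ (InΓ-red-injective x∈Γ y∈Γ (trans (sym (red-φ x)) (trans e (red-φ y))))
    red-φ∘teich : ∀ v → red (φ (teich (evalᵛ v))) ≡ v
    red-φ∘teich v = trans (red-φ _) (trans (red-teich (evalᵛ v)) (red-evalᵛ v))
    lift-injective : ∀ {v w} → v ∈ allBits (suc m) → w ∈ allBits (suc m) →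
                     φ (teich (evalᵛ v)) ≡ φ (teich (evalᵛ w)) → v ≡ w
    lift-injective {v} {w} _ _ e = trans (sym (red-φ∘teich v)) (trans (cong red e) (red-φ∘teich w))

  In2R-double : ∀ r → In2R (two· r)
  In2R-double r = lose (∈-allR r) refl

  ∉2R⇒nonzero-part : ∀ {a b} → ¬ In2R (a +R two· b) → a ≢ 0R
  ∉2R⇒nonzero-part {a} {b} ∉2R refl = ∉2R (subst In2R (sym (⊞-identityˡ (two· b))) (In2R-double b))

  In2R⇒red≡0 : ∀ {g} → In2R g → red g ≡ zeros
  In2R⇒red≡0 g∈2R with find g∈2R
  ... | r , _ , refl = red-double r

  ∈-Pairs-Δ⁺ : ∀ {a b y} → InΓ a → InΓ b → InΓ y → Δ a y ≡ b *R b → (φ (y ⊕ a) , φ y) ∈ Pairs (a +R two· b)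
  ∈-Pairs-Δ⁺ a∈Γ b∈Γ y∈Γ Δ≡b² =
    ∈-Pairs⁺ (InΓ-⊕ y∈Γ a∈Γ) y∈Γ (φ-difference⇐ (InΓ-⊕ y∈Γ a∈Γ) y∈Γ a∈Γ b∈Γ refl Δ≡b²)

  ∈-Pairs-Δ⁻ : ∀ {a b p} → InΓ a → InΓ b → p ∈ Pairs (a +R two· b) →
               ∃ λ y → InΓ y × Δ a y ≡ b *R b × p ≡ (φ (y ⊕ a) , φ y)
  ∈-Pairs-Δ⁻ {a} {b} a∈Γ b∈Γ p∈ = from (∈-Pairs⁻ p∈)
    where
    from : ∀ {p} → (∃ λ x → ∃ λ y → InΓ x × InΓ y × p ≡ (φ x , φ y) × φ x -R φ y ≡ a +R two· b) →
           ∃ λ y → InΓ y × Δ a y ≡ b *R b × p ≡ (φ (y ⊕ a) , φ y)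
    from (x , y , x∈Γ , y∈Γ , p≡ , diff) =
      y , y∈Γ , proj₂ x≡∧Δ≡ , trans p≡ (cong (λ z → φ z , φ y) (proj₁ x≡∧Δ≡))
      where
      x≡∧Δ≡ : x ≡ y ⊕ a × Δ a y ≡ b *R b
      x≡∧Δ≡ = φ-difference⇒ x∈Γ y∈Γ a∈Γ b∈Γ diff

  planar⇒one-representation : Planar f → ∀ g → ¬ In2R g → diffCount D g ≡ 1
  planar⇒one-representation planar g g∉2R = count (Γ-decomposition g)
    where
    count : (∃ λ a → ∃ λ b → InΓ a × InΓ b × g ≡ a +R two· b) → diffCount D g ≡ 1
    count (a , b , a∈Γ , b∈Γ , g≡a+2b) =
      subst (λ t → diffCount D t ≡ 1) (sym g≡a+2b)
            (length≡1 (Pairs-unique (a +R two· b)) (∈-Pairs-Δ⁺ a∈Γ b∈Γ y₀∈Γ Δay₀≡b²) all≡)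
      where
      Δa-permutes : PermΓ (Δ a)
      Δa-permutes = planar a a∈Γ (∉2R⇒nonzero-part (subst (λ t → ¬ In2R t) g≡a+2b g∉2R))
      preimage = proj₂ (proj₂ Δa-permutes) (b *R b) (InΓ-square b)
      y₀ : R
      y₀ = proj₁ preimage
      y₀∈Γ : InΓ y₀
      y₀∈Γ = proj₁ (proj₂ preimage)
      Δay₀≡b² : Δ a y₀ ≡ b *R b
      Δay₀≡b² = proj₂ (proj₂ preimage)
      all≡ : ∀ {p} → p ∈ Pairs (a +R two· b) → p ≡ (φ (y₀ ⊕ a) , φ y₀)
      all≡ p∈ = unique (∈-Pairs-Δ⁻ a∈Γ b∈Γ p∈)
        where
        unique : ∀ {p} → (∃ λ y → InΓ y × Δ a y ≡ b *R b × p ≡ (φ (y ⊕ a) , φ y)) → p ≡ (φ (y₀ ⊕ a) , φ y₀)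
        unique (y , y∈Γ , Δay≡b² , p≡) = trans p≡ (cong (λ z → φ (z ⊕ a) , φ z) y≡y₀)
          where
          y≡y₀ : y ≡ y₀
          y≡y₀ = proj₁ (proj₂ Δa-permutes) y y₀ y∈Γ y₀∈Γ (trans Δay≡b² (sym Δay₀≡b²))

  -- φ x − φ y ∈ 2R forces x ⊕ y ≡ 0 mod 2, i.e. x = y
  no-representation-in-2R : ∀ g → In2R g → g ≢ 0R → diffCount D g ≡ 0
  no-representation-in-2R g g∈2R g≢0 = length≡0 (Pairs g) ∉Pairs
    where
    ∉Pairs : ∀ {p} → ¬ p ∈ Pairs g
    ∉Pairs p∈ with ∈-Pairs⁻ p∈
    ... | x , y , x∈Γ , y∈Γ , refl , diff = g≢0 (trans (sym diff) (trans (cong (λ z → φ z -R φ y) x≡y) (⊞-inverseʳ (φ y))))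
      where
      red-x⊕y≡0 : red (x ⊕ y) ≡ zeros
      red-x⊕y≡0 = begin
        red (x ⊕ y)                                  ≡⟨ sym (red-+double (x ⊕ y) (teich (κ x y))) ⟩
        red ((x ⊕ y) +R two· (teich (κ x y)))        ≡⟨ cong red (sym (φ-difference x y)) ⟩
        red (φ x -R φ y)                             ≡⟨ cong red diff ⟩
        red g                                        ≡⟨ In2R⇒red≡0 g∈2R ⟩
        zeros                                        ∎
      x≡y : x ≡ y
      x≡y = InΓ-red-injective x∈Γ y∈Γ (⊻≡zeros⇒≡ (red x) (red y) (trans (sym (red-⊕ x y)) red-x⊕y≡0))

  one-representation⇒planar : (∀ g → ¬ In2R g → diffCount D g ≡ 1) → Planar f
  one-representation⇒planar one ε ε∈Γ ε≢0 = (λ x x∈Γ → InΓ-Δ ε∈Γ x∈Γ) , injective , surjective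
    where
    ε+2b∉2R : ∀ b → ¬ In2R (ε +R two· b)
    ε+2b∉2R b ε+2b∈2R = ε≢0 (InΓ-red-injective ε∈Γ InΓ-0 (begin
      red ε                   ≡⟨ sym (red-+double ε b) ⟩
      red (ε +R two· b)       ≡⟨ In2R⇒red≡0 ε+2b∈2R ⟩
      zeros                   ≡⟨ sym (red-zs {suc m}) ⟩
      red 0R                  ∎))
    injective : ∀ x y → InΓ x → InΓ y → Δ ε x ≡ Δ ε y → x ≡ y
    injective x y x∈Γ y∈Γ Δx≡Δy = φ-injective x∈Γ y∈Γ (cong proj₂ (length≡1⇒∈⇒≡ (Pairs g) (one g (ε+2b∉2R b))
      (∈-Pairs-Δ⁺ ε∈Γ b∈Γ x∈Γ (sym b²)) (∈-Pairs-Δ⁺ ε∈Γ b∈Γ y∈Γ (trans (sym Δx≡Δy) (sym b²)))))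
      where
      b = sqrtΓ (Δ ε x)
      b∈Γ : InΓ b
      b∈Γ = proj₁ (sqrtΓ-spec (InΓ-Δ ε∈Γ x∈Γ))
      b² : b *R b ≡ Δ ε x
      b² = proj₂ (sqrtΓ-spec (InΓ-Δ ε∈Γ x∈Γ))
      g = ε +R two· b
    surjective : ∀ c → InΓ c → ∃ λ y → InΓ y × Δ ε y ≡ c
    surjective c c∈Γ =
      preimage (∈-Pairs-Δ⁻ ε∈Γ b∈Γ (proj₂ (length≡1⇒nonempty (Pairs (ε +R two· b)) (one _ (ε+2b∉2R b)))))
      where
      b = sqrtΓ c
      b∈Γ : InΓ b
      b∈Γ = proj₁ (sqrtΓ-spec c∈Γ)
      b² : b *R b ≡ c
      b² = proj₂ (sqrtΓ-spec c∈Γ)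
      preimage : ∀ {p} → (∃ λ y → InΓ y × Δ ε y ≡ b *R b × p ≡ (φ (y ⊕ ε) , φ y)) → ∃ λ y → InΓ y × Δ ε y ≡ c
      preimage (y , y∈Γ , Δ≡b² , _) = y , y∈Γ , trans Δ≡b² b²

theorem2p1 : (n : ℕ) → 1 ≤ n → (hs : Vec Z4 n) → BasicIrreducible hs →
    let open GR n hs in
    (f : R → R) → (∀ x → InΓ x → InΓ (f x)) →
    (IsRDS (Dlist f) In2R In2R? (2 ^ n) (2 ^ n) (2 ^ n) 1 ⇔ Planar f)
theorem2p1 (suc m) (s≤s z≤n) hs irr f f∈Γ = mk⇔
  (λ (_ , _ , _ , one-representation , _) → one-representation⇒planar one-representation)
  (λ planar → length-allVec (suc m) , length-2R , length-D , planar⇒one-representation planar , no-representation-in-2R)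
  where
  open Cardinalities m hs
  open DifferenceSet m hs irr f f∈Γ
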